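{- Let $G$ be a simple odd multi-cactus with $G\neq K_2$, and let $u,v$ be two vertices of $G$ in the same bipartition class (possibly $u=v$). Then there is a map $w:E(G)\to\{0,1\}$ such that, after increasing the weighted degree of $u$ by $1$ and the weighted degree of $v$ by $1$ (so increasing it by $2$ if $u=v$), any two adjacent vertices have different (modified) weighted degrees.
   Context: An odd multi-cactus: take a collection of cycles of length $2 \pmod 4$, each with edges coloured alternately red and green; form a connected simple graph by pasting these cycles together one by one in a tree-like fashion along green edges; finally replace every green edge by a multiple edge of any multiplicity. A simple odd multi-cactus is one in which all multiplicities are $1$. For $w:E(G)\to\{0,1\}$, the weighted degree of a vertex $x$ is $\sum_{e\ni x}w(e)$. -}

module Defs where

open import Data.Nat using (ℕ; zero; suc; _+_; _*_)
open import Data.Bool using (Bool; true; false; _∧_; _∨_; if_then_else_)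
open import Data.Fin using (Fin; zero; suc; _↑ˡ_; _↑ʳ_; fromℕ; _≟_)
open import Data.List using (List; []; _∷_; _++_; map; allFin)
open import Data.Bool.ListAction using (any)
open import Data.Nat.ListAction using (sum)
open import Data.List.Membership.Propositional using (_∈_)
open import Data.Product using (_×_; _,_; ∃)
open import Relation.Nullary.Decidable using (⌊_⌋)
open import Relation.Binary.PropositionalEquality using (_≡_)
open import Function.Bundles using (_↔_; Inverse)

record SimpleGraph : Set where
  field
    n     : ℕ
    Adj   : Fin n → Fin n → Bool
    sym   : ∀ x y → Adj x y ≡ Adj y x
    irrefl : ∀ x → Adj x x ≡ false

open SimpleGraph public

record _≅_ (G H : SimpleGraph) : Set where
  field
    bij      : Fin (n G) ↔ Fin (n H)
    preserve : ∀ x y → Adj G x y ≡ Adj H (Inverse.to bij x) (Inverse.to bij y)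

K2 : SimpleGraph
K2 = record { n = 2 ; Adj = adj ; sym = s ; irrefl = i }
  where
  adj : Fin 2 → Fin 2 → Bool
  adj zero (suc zero) = true
  adj (suc zero) zero = true
  adj _ _ = false
  s : ∀ x y → adj x y ≡ adj y x
  s zero zero = _≡_.refl
  s zero (suc zero) = _≡_.refl
  s (suc zero) zero = _≡_.refl
  s (suc zero) (suc zero) = _≡_.refl
  i : ∀ x → adj x x ≡ false
  i zero = _≡_.refl
  i (suc zero) = _≡_.refl

Edge : ℕ → Set
Edge n = Fin n × Fin n

mapE : ∀ {m k} → (Fin m → Fin k) → Edge m → Edge k
mapE f (a , b) = f a , f b

pathEdges : (len : ℕ) → List (Edge len)
pathEdges zero = []
pathEdges (suc zero) = []
pathEdges (suc (suc l)) = (zero , suc zero) ∷ map (mapE suc) (pathEdges (suc l))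

evenPairs : (len : ℕ) → List (Edge len)
evenPairs zero = []
evenPairs (suc zero) = []
evenPairs (suc (suc l)) = (zero , suc zero) ∷ map (mapE (λ i → suc (suc i))) (evenPairs l)

cycleEdges : (l : ℕ) → List (Edge (suc l))
cycleEdges l = (fromℕ l , zero) ∷ pathEdges (suc l)

-- Pasting a cycle  a - b - new₀ - new₁ - ... - new_{t-1} - a  (t new vertices)
-- onto the edge (a , b) of a graph on n vertices.
connectors : (n t : ℕ) → Fin n → Fin n → List (Edge (n + t))
connectors n zero a b = []
connectors n (suc t) a b =
  (b ↑ˡ suc t , n ↑ʳ zero) ∷ (n ↑ʳ fromℕ t , a ↑ˡ suc t) ∷ []

pasteEdges : (n t : ℕ) → List (Edge n) → Fin n → Fin n → List (Edge (n + t))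
pasteEdges n t es a b =
  map (mapE (_↑ˡ t)) es ++ map (mapE (n ↑ʳ_)) (pathEdges t) ++ connectors n t a b

pasteGreens : (n t : ℕ) → List (Edge n) → List (Edge (n + t))
pasteGreens n t gs = map (mapE (_↑ˡ t)) gs ++ map (mapE (n ↑ʳ_)) (evenPairs t)

-- OddCactus n es gs : the (simple) graph on Fin n with edge list es and
-- green-edge list gs arises by the construction: start with a cycle of
-- length 4k+2 coloured alternately (green edges (2j,2j+1)), and repeatedly
-- paste a new cycle of length 4k+2 along a green edge (a , b), the new cycle
-- being coloured alternately with (a , b) green.
data OddCactus : (n : ℕ) → List (Edge n) → List (Edge n) → Set where
  cyc   : (k : ℕ) →
          OddCactus (suc (suc (4 * k))) (cycleEdges (suc (4 * k))) (evenPairs (suc (suc (4 * k))))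
  paste : ∀ {n es gs} → OddCactus n es gs →
          (a b : Fin n) → (a , b) ∈ gs → (k : ℕ) →
          OddCactus (n + 4 * k) (pasteEdges n (4 * k) es a b) (pasteGreens n (4 * k) gs)

listAdj : ∀ {n} → List (Edge n) → Fin n → Fin n → Bool
listAdj es x y =
  any (λ e → (⌊ x ≟ Data.Product.proj₁ e ⌋ ∧ ⌊ y ≟ Data.Product.proj₂ e ⌋)
           ∨ (⌊ x ≟ Data.Product.proj₂ e ⌋ ∧ ⌊ y ≟ Data.Product.proj₁ e ⌋)) es

IsSimpleOddMultiCactus : SimpleGraph → Set
IsSimpleOddMultiCactus G =
  ∃ λ (m : ℕ) → ∃ λ (es : List (Edge m)) → ∃ λ (gs : List (Edge m)) →
    OddCactus m es gs ×
    ∃ λ (σ : Fin (n G) ↔ Fin m) →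
      ∀ x y → Adj G x y ≡ listAdj es (Inverse.to σ x) (Inverse.to σ y)

ProperTwoColouring : (G : SimpleGraph) → (Fin (n G) → Bool) → Set
ProperTwoColouring G c = ∀ x y → Adj G x y ≡ true → c x ≡ c y → Data.Empty.⊥
  where import Data.Empty

-- u and v lie in the same bipartition class (G connected, so the
-- bipartition is unique)
SameClass : (G : SimpleGraph) → Fin (n G) → Fin (n G) → Set
SameClass G u v = ∃ λ (c : Fin (n G) → Bool) → ProperTwoColouring G c × c u ≡ c v

-- Weighted degrees.  An edge weighting w : E(G) → {0,1} is represented by
-- a symmetric function w : Fin n → Fin n → Bool (values on non-edges are
-- irrelevant).

bit : Bool → ℕ
bit true = 1
bit false = 0

weightedDegree : (G : SimpleGraph) → (Fin (n G) → Fin (n G) → Bool) → Fin (n G) → ℕ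
weightedDegree G w x = sum (map (λ y → bit (Adj G x y ∧ w x y)) (allFin (n G)))

modifiedDegree : (G : SimpleGraph) → (Fin (n G) → Fin (n G) → Bool) →
                 Fin (n G) → Fin (n G) → Fin (n G) → ℕ
modifiedDegree G w u v x =
  weightedDegree G w x + bit ⌊ u ≟ x ⌋ + bit ⌊ v ≟ x ⌋

-- Induction along the construction of the cactus, with a stronger hypothesis (Invariant): every
-- green edge ab is an edge, and for each end z of it and each s ∈ {0,1} there is a good weighting
-- with bonus 1 at z in which z has degree s+1 and the other end degree s.  "Good" also demands that
-- no green pair has degrees {0,2}.  A cycle of length 4k+2 pasted on ab adds a path of 4k new
-- vertices from b to a, and a good weighting of the old graph extends once the 4k+1 new edges are
-- weighted: a bonus sitting at a or at b may be traded for weight 1 on the new edge there, leaving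
-- every old degree unchanged.  Weighting the path is a finite-state problem, scanned edge by edge
-- with only the last edge weight and the last degree remembered.  Inserting four bonus-free vertices
-- after a bonus-free vertex preserves solvability, which reduces every case to short paths; since
-- path degrees are at most 4 the degrees at a and b only matter up to 5, and the remaining finitely
-- many cases are decided by exhaustive search.  A cycle is K₂ with such a path attached.

module Submission where

open import Defs
open import Data.Bool using (Bool; true)
open import Data.Fin using (Fin)
open import Data.Product using (_×_; ∃)
open import Relation.Nullary using (¬_)
open import Relation.Binary.PropositionalEquality using (_≡_; _≢_)

open import Data.Bool using (false; not; _∧_; _∨_; T; if_then_else_)
open import Data.Bool.ListAction using (all)
open import Data.Bool.Properties using (T?; T-∧; T-∨; T-≡; T-not-≡; not-involutive; ∨-identityʳ; ∨-zeroʳ; ∧-zeroʳ; ∧-identityʳ; ∨-assoc; ∨-comm; ∧-comm) renaming (_≟_ to _≟ᵇ_)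
open import Data.Empty using (⊥-elim)
open import Data.Fin using (zero; suc; toℕ; _↑ˡ_; _↑ʳ_; fromℕ; fromℕ<; _≟_; splitAt; cast)
open import Data.Fin.Properties using (suc-injective; ↑ˡ-injective; ↑ʳ-injective; toℕ-↑ˡ; toℕ-↑ʳ; toℕ<n; toℕ≤pred[n]; toℕ-injective; toℕ-fromℕ; toℕ-fromℕ<; fromℕ<-toℕ; toℕ-cast; splitAt-↑ˡ; splitAt-↑ʳ; splitAt⁻¹-↑ˡ; splitAt⁻¹-↑ʳ)
open import Data.List using (List; []; _∷_; _++_; map; tabulate; allFin; upTo; applyUpTo)
open import Data.List.Membership.Propositional using (_∈_)
open import Data.List.Membership.Propositional.Properties using (∈-map⁻; ∈-++⁻)
open import Data.List.Properties using (map-tabulate)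
open import Data.List.Relation.Unary.Any using (here; there)
open import Data.Maybe using (Maybe; just; nothing; is-just; to-witness-T; _<∣>_)
import Data.Maybe as Maybe
open import Data.Nat using (ℕ; zero; suc; _+_; _*_; _⊓_; _≡ᵇ_; _<ᵇ_; _≤ᵇ_; _≤_; _<_; z≤n; s≤s)
import Data.Nat.ListAction as List
open import Data.Nat.Properties using (>⇒≢; +-suc; +-comm; +-assoc; +-identityʳ; +-cancelˡ-≡; +-mono-≤; +-monoʳ-<; *-suc; ⊓-comm; ≡ᵇ⇒≡; ≡⇒≡ᵇ; ≤ᵇ⇒≤; ≤-refl; ≤∧≢⇒<; <-≤-trans; <-trans; <⇒≤; <⇒≢; <⇒≱; <-irrefl; m≤m+n; m<m+n; m≤n⇒m≤1+n; n≤1+n; n<1+n)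
import Data.Nat.Properties as ℕ
open import Algebra.Properties.CommutativeMonoid.Sum ℕ.+-0-commutativeMonoid using (sum; sum-cong-≗; ∑-distrib-+; sum-replicate-zero; sum-permute)
open import Data.Product using (_,_; proj₁; proj₂; ∃₂)
open import Data.Sum using (_⊎_; inj₁; inj₂)
open import Data.Unit using (tt)
open import Function using (_∘_; id; _⟨_⟩_; case_of_)
open import Function.Bundles using (_↔_; Inverse; Equivalence; mk↔ₛ′)
open import Relation.Binary using (Tri; tri<; tri≈; tri>)
open import Relation.Binary.PropositionalEquality as ≡ using (refl; trans; cong; cong₂; subst; subst₂)
open import Relation.Nullary using (yes; no)
open import Relation.Nullary.Decidable using (⌊_⌋; dec-true; dec-false; isYes≗does; toWitness)

T-∧ˡ : ∀ {a b} → T (a ∧ b) → T a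
T-∧ˡ {true} _ = tt

T-∧ʳ : ∀ {a b} → T (a ∧ b) → T b
T-∧ʳ {true} h = h

_⇒_ : Bool → Bool → Bool
a ⇒ b = not a ∨ b

⇒-elim : ∀ {a b} → T (a ⇒ b) → T a → T b
⇒-elim {true} h _ = h

T-not-≡ᵇ : ∀ {m n} → T (not (m ≡ᵇ n)) → m ≢ n
T-not-≡ᵇ {m} h refl = subst (T ∘ not) (dec-true (m ℕ.≟ m) refl) h

≡ᵇ-refl : ∀ J → (J ≡ᵇ J) ≡ true
≡ᵇ-refl J = dec-true (J ℕ.≟ J) refl

≡ᵇ-false : ∀ {m n} → m ≢ n → (m ≡ᵇ n) ≡ false
≡ᵇ-false {m} {n} m≢n = dec-false (m ℕ.≟ n) m≢n

T-≢ : ∀ {m n} → m ≢ n → T (not (m ≡ᵇ n))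
T-≢ ne = Equivalence.from T-not-≡ (≡ᵇ-false ne)

≡ᵇ-below : ∀ {J k} → k < J → (J ≡ᵇ k) ≡ false
≡ᵇ-below k<J = ≡ᵇ-false (>⇒≢ k<J)

≡ᵇ-above : ∀ J k → (J ≡ᵇ J + suc k) ≡ false
≡ᵇ-above J k = ≡ᵇ-false (<⇒≢ (m<m+n J (s≤s z≤n)))

≡ᵇ-suc-below : ∀ {J k} → k ≤ J → (suc J ≡ᵇ k) ≡ false
≡ᵇ-suc-below k≤J = ≡ᵇ-below (s≤s k≤J)

<ᵇ-true : ∀ {m n} → m < n → (m <ᵇ n) ≡ true
<ᵇ-true {m} {n} m<n = dec-true (m ℕ.<? n) m<n

<ᵇ-false : ∀ {m n} → ¬ m < n → (m <ᵇ n) ≡ false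
<ᵇ-false {m} {n} m≮n = dec-false (m ℕ.<? n) m≮n

bit≤1 : ∀ b → bit b ≤ 1
bit≤1 false = z≤n
bit≤1 true = s≤s z≤n

bool-third : ∀ {x y z : Bool} → x ≢ z → y ≢ z → x ≡ y
bool-third {false} {false} _ _ = refl
bool-third {true} {true} _ _ = refl
bool-third {false} {true} {false} x≢z _ = ⊥-elim (x≢z refl)
bool-third {false} {true} {true} _ y≢z = ⊥-elim (y≢z refl)
bool-third {true} {false} {false} _ y≢z = ⊥-elim (y≢z refl)
bool-third {true} {false} {true} x≢z _ = ⊥-elim (x≢z refl)

trans-≢ : ∀ {A : Set} {x y z : A} → x ≢ y → y ≡ z → x ≢ z
trans-≢ x≢y refl = x≢y

decompose : ∀ {J t} → J < t → ∃ λ r → t ≡ J + suc r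
decompose {J} J<t = let r , 1+J+r≡t = ℕ.m≤n⇒∃[o]m+o≡n J<t in r , ≡.sym (trans (+-suc J r) 1+J+r≡t)

even : ℕ → Bool
even zero = true
even (suc zero) = false
even (suc (suc n)) = even n

even-suc : ∀ k → even (suc k) ≡ not (even k)
even-suc zero = refl
even-suc (suc zero) = refl
even-suc (suc (suc k)) = even-suc k

odd-suc : ∀ k → T (even k) → T (not (even (suc k)))
odd-suc zero _ = tt
odd-suc (suc (suc k)) h = odd-suc k h

odd-gap : ∀ J m → even J ≡ even (J + suc m) → T (not (even m))
odd-gap zero m eq = subst T (trans eq (even-suc m)) tt
odd-gap (suc zero) m eq = subst (T ∘ not) eq tt
odd-gap (suc (suc J)) m eq = odd-gap J m eq

multipleOf4 : ℕ → Bool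
multipleOf4 zero = true
multipleOf4 (suc (suc (suc (suc n)))) = multipleOf4 n
multipleOf4 _ = false

+4-inside : ∀ a b → a + (4 + b) ≡ 4 + (a + b)
+4-inside a b rewrite +-suc a (3 + b) | +-suc a (2 + b) | +-suc a (1 + b) | +-suc a b = refl

multipleOf4-skip : ∀ a b → T (multipleOf4 (a + (4 + b))) → T (multipleOf4 (a + b))
multipleOf4-skip a b = subst (T ∘ multipleOf4) (+4-inside a b)

multipleOf4-4* : ∀ k → T (multipleOf4 (4 * k))
multipleOf4-4* zero = tt
multipleOf4-4* (suc k) rewrite *-suc 4 k = multipleOf4-4* k

all-upTo : ∀ (p : ℕ → Bool) {n} → T (all p (upTo n)) → ∀ {m} → m < n → T (p m)
all-upTo p h = go id h
  where
  go : ∀ {n} (f : ℕ → ℕ) → T (all p (applyUpTo f n)) → ∀ {m} → m < n → T (p (f m))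
  go {suc n} f h {zero} _ = proj₁ (Equivalence.to T-∧ h)
  go {suc n} f h {suc m} (s≤s m<n) = go (f ∘ suc) (proj₂ (Equivalence.to T-∧ h)) m<n

≟-injective : ∀ {m k} (f : Fin m → Fin k) → (∀ {x y} → f x ≡ f y → x ≡ y) → ∀ x y → ⌊ f x ≟ f y ⌋ ≡ ⌊ x ≟ y ⌋
≟-injective f inj x y with x ≟ y | f x ≟ f y
... | yes _ | yes _ = refl
... | no _ | no _ = refl
... | yes refl | no fx≢fx = ⊥-elim (fx≢fx refl)
... | no x≢y | yes fx≡fy = ⊥-elim (x≢y (inj fx≡fy))

≟-refl : ∀ {n} (x : Fin n) → ⌊ x ≟ x ⌋ ≡ true
≟-refl x = trans (isYes≗does (x ≟ x)) (dec-true (x ≟ x) refl)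

≟-false : ∀ {n} {x y : Fin n} → x ≢ y → ⌊ x ≟ y ⌋ ≡ false
≟-false {x = x} {y} x≢y = trans (isYes≗does (x ≟ y)) (dec-false (x ≟ y) x≢y)

≟-sym : ∀ {n} (x y : Fin n) → ⌊ x ≟ y ⌋ ≡ ⌊ y ≟ x ⌋
≟-sym x y with x ≟ y
... | yes refl = ≡.sym (≟-refl x)
... | no x≢y = ≡.sym (≟-false (x≢y ∘ ≡.sym))

≟-toℕ : ∀ {k} (p q : Fin k) → ⌊ p ≟ q ⌋ ≡ (toℕ p ≡ᵇ toℕ q)
≟-toℕ zero zero = refl
≟-toℕ zero (suc q) = refl
≟-toℕ (suc p) zero = refl
≟-toℕ (suc p) (suc q) = trans (≟-injective suc suc-injective p q) (≟-toℕ p q)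

↑ˡ≢↑ʳ : ∀ {n t} (i : Fin n) (p : Fin t) → i ↑ˡ t ≢ n ↑ʳ p
↑ˡ≢↑ʳ {n} {t} i p eq = <⇒≢ (<-≤-trans (toℕ<n i) (m≤m+n n (toℕ p)))
  (trans (≡.sym (toℕ-↑ˡ i t)) (trans (cong toℕ eq) (toℕ-↑ʳ n p)))

module _ {n t : ℕ} where

  ↑ˡ≟↑ˡ : ∀ (i j : Fin n) → ⌊ i ↑ˡ t ≟ j ↑ˡ t ⌋ ≡ ⌊ i ≟ j ⌋
  ↑ˡ≟↑ˡ = ≟-injective (_↑ˡ t) (↑ˡ-injective t _ _)

  ↑ʳ≟↑ʳ : ∀ (p q : Fin t) → ⌊ n ↑ʳ p ≟ n ↑ʳ q ⌋ ≡ ⌊ p ≟ q ⌋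
  ↑ʳ≟↑ʳ = ≟-injective (n ↑ʳ_) (↑ʳ-injective n _ _)

  ↑ˡ≟↑ʳ : ∀ (i : Fin n) (p : Fin t) → ⌊ i ↑ˡ t ≟ n ↑ʳ p ⌋ ≡ false
  ↑ˡ≟↑ʳ i p = ≟-false (↑ˡ≢↑ʳ i p)

  ↑ʳ≟↑ˡ : ∀ (p : Fin t) (i : Fin n) → ⌊ n ↑ʳ p ≟ i ↑ˡ t ⌋ ≡ false
  ↑ʳ≟↑ˡ p i = ≟-false (↑ˡ≢↑ʳ i p ∘ ≡.sym)

data View (n t : ℕ) : Fin (n + t) → Set where
  old : (i : Fin n) → View n t (i ↑ˡ t)
  new : (p : Fin t) → View n t (n ↑ʳ p)

view : ∀ n t (x : Fin (n + t)) → View n t x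
view n t x with splitAt n x in eq
... | inj₁ i = subst (View n t) (splitAt⁻¹-↑ˡ eq) (old i)
... | inj₂ p = subst (View n t) (splitAt⁻¹-↑ʳ eq) (new p)

sum-allFin : ∀ n (f : Fin n → ℕ) → List.sum (map f (allFin n)) ≡ sum f
sum-allFin n f = trans (cong List.sum (map-tabulate id f)) (tabulated n f)
  where
  tabulated : ∀ n (f : Fin n → ℕ) → List.sum (tabulate f) ≡ sum f
  tabulated zero f = refl
  tabulated (suc n) f = cong (f zero +_) (tabulated n (f ∘ suc))

sum-↑ : ∀ n t (f : Fin (n + t) → ℕ) → sum f ≡ sum (f ∘ (_↑ˡ t)) + sum (f ∘ (n ↑ʳ_))
sum-↑ zero t f = refl
sum-↑ (suc n) t f = trans (cong (f zero +_) (sum-↑ n t (f ∘ suc))) (≡.sym (+-assoc (f zero) _ _))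

sum-zeros : ∀ {n} (f : Fin n → ℕ) → (∀ i → f i ≡ 0) → sum f ≡ 0
sum-zeros {n} f h = trans (sum-cong-≗ h) (sum-replicate-zero n)

sum-point : ∀ {n} (c : Fin n) (X : Fin n → Bool) → sum (λ i → bit (⌊ i ≟ c ⌋ ∧ X i)) ≡ bit (X c)
sum-point {suc n} zero X =
  trans (cong (bit (X zero) +_) (sum-zeros {n} (λ i → bit (⌊ suc i ≟ zero ⌋ ∧ X (suc i))) (λ _ → refl))) (+-identityʳ _)
sum-point {suc n} (suc c) X =
  trans (sum-cong-≗ {n} λ i → cong (λ b → bit (b ∧ X (suc i))) (≟-injective suc suc-injective i c)) (sum-point c (X ∘ suc))

sum-pointℕ : ∀ t m (X : ℕ → Bool) → sum {t} (λ q → bit ((m ≡ᵇ toℕ q) ∧ X (toℕ q))) ≡ (if m <ᵇ t then bit (X m) else 0)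
sum-pointℕ zero m X = refl
sum-pointℕ (suc t) zero X =
  trans (cong (bit (X 0) +_) (sum-zeros {t} (λ q → bit ((0 ≡ᵇ suc (toℕ q)) ∧ X (suc (toℕ q)))) (λ _ → refl))) (+-identityʳ _)
sum-pointℕ (suc t) (suc m) X = sum-pointℕ t m (X ∘ suc)

-- Graphs given by edge lists, and a path attached to two old vertices

Adjacency : ℕ → Set
Adjacency n = Fin n → Fin n → Bool

listAdj-++ : ∀ {k} (xs ys : List (Edge k)) x y → listAdj (xs ++ ys) x y ≡ (listAdj xs x y ∨ listAdj ys x y)
listAdj-++ [] ys x y = refl
listAdj-++ ((u , v) ∷ xs) ys x y =
  trans (cong (((⌊ x ≟ u ⌋ ∧ ⌊ y ≟ v ⌋) ∨ (⌊ x ≟ v ⌋ ∧ ⌊ y ≟ u ⌋)) ∨_) (listAdj-++ xs ys x y))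
        (≡.sym (∨-assoc _ (listAdj xs x y) (listAdj ys x y)))

listAdj-sym : ∀ {k} (es : List (Edge k)) x y → listAdj es x y ≡ listAdj es y x
listAdj-sym [] x y = refl
listAdj-sym ((u , v) ∷ es) x y = cong₂ _∨_ (swap ⌊ x ≟ u ⌋ ⌊ y ≟ v ⌋ ⌊ x ≟ v ⌋ ⌊ y ≟ u ⌋) (listAdj-sym es x y)
  where
  swap : ∀ a b c d → ((a ∧ b) ∨ (c ∧ d)) ≡ ((d ∧ c) ∨ (b ∧ a))
  swap a b c d = trans (∨-comm (a ∧ b) (c ∧ d)) (cong₂ _∨_ (∧-comm c d) (∧-comm a b))

listAdj-map : ∀ {k k′} (g : Fin k → Fin k′) (es : List (Edge k)) {x y x′ y′} →
  (∀ u → ⌊ x′ ≟ g u ⌋ ≡ ⌊ x ≟ u ⌋) → (∀ u → ⌊ y′ ≟ g u ⌋ ≡ ⌊ y ≟ u ⌋) →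
  listAdj (map (mapE g) es) x′ y′ ≡ listAdj es x y
listAdj-map g [] hx hy = refl
listAdj-map g ((u , v) ∷ es) hx hy
  rewrite hx u | hx v | hy u | hy v = cong (_ ∨_) (listAdj-map g es hx hy)

listAdj-outside : ∀ {k k′} (g : Fin k → Fin k′) (es : List (Edge k)) x y →
  (∀ u → ⌊ x ≟ g u ⌋ ≡ false) → listAdj (map (mapE g) es) x y ≡ false
listAdj-outside g [] x y hx = refl
listAdj-outside g ((u , v) ∷ es) x y hx rewrite hx u | hx v = listAdj-outside g es x y hx

consecutive : ℕ → ℕ → Bool
consecutive i j = (suc i ≡ᵇ j) ∨ (i ≡ᵇ suc j)

consecutive-true : ∀ P Q → consecutive P Q ≡ true → suc P ≡ Q ⊎ P ≡ suc Q
consecutive-true P Q h with Equivalence.to T-∨ (Equivalence.from T-≡ h)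
... | inj₁ h₁ = inj₁ (ℕ.≡ᵇ⇒≡ (suc P) Q h₁)
... | inj₂ h₂ = inj₂ (ℕ.≡ᵇ⇒≡ P (suc Q) h₂)

pathEdges-adj : ∀ t (p q : Fin t) → listAdj (pathEdges t) p q ≡ consecutive (toℕ p) (toℕ q)
pathEdges-adj (suc zero) zero zero = refl
pathEdges-adj (suc (suc l)) zero q =
  trans (cong (((true ∧ ⌊ q ≟ suc zero ⌋) ∨ (false ∧ ⌊ q ≟ zero ⌋)) ∨_)
              (listAdj-outside suc (pathEdges (suc l)) zero q (λ _ → refl))) (first q)
  where
  first : ∀ q → (((true ∧ ⌊ q ≟ suc zero ⌋) ∨ (false ∧ ⌊ q ≟ zero ⌋)) ∨ false) ≡ consecutive 0 (toℕ q)
  first zero = refl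
  first (suc zero) = refl
  first (suc (suc q)) = refl
pathEdges-adj (suc (suc l)) (suc p) zero =
  trans (cong (((false ∧ false) ∨ (⌊ suc p ≟ suc zero ⌋ ∧ true)) ∨_)
              (trans (listAdj-sym (map (mapE suc) (pathEdges (suc l))) (suc p) zero)
                     (listAdj-outside suc (pathEdges (suc l)) zero (suc p) (λ _ → refl)))) (first p)
  where
  first : ∀ p → (((false ∧ false) ∨ (⌊ suc p ≟ suc zero ⌋ ∧ true)) ∨ false) ≡ consecutive (suc (toℕ p)) 0
  first zero = refl
  first (suc p) = refl
pathEdges-adj (suc (suc l)) (suc p) (suc q) rewrite ∧-zeroʳ ⌊ suc p ≟ suc zero ⌋ =
  trans (listAdj-map suc (pathEdges (suc l)) (≟-injective suc suc-injective p) (≟-injective suc suc-injective q))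
    (pathEdges-adj (suc l) p q)

attachments : ∀ {n} t′ (a b : Fin n) → Fin n → Fin (suc t′) → Bool
attachments t′ a b i p = (⌊ i ≟ b ⌋ ∧ ⌊ p ≟ zero ⌋) ∨ (⌊ i ≟ a ⌋ ∧ ⌊ p ≟ fromℕ t′ ⌋)

attachments-true : ∀ {n} t′ {a b : Fin n} i p → attachments t′ a b i p ≡ true → (i ≡ b × p ≡ zero) ⊎ (i ≡ a × p ≡ fromℕ t′)
attachments-true t′ {a} {b} i p h with Equivalence.to T-∨ (Equivalence.from T-≡ h)
... | inj₁ h₁ = inj₁ (toWitness {a? = i ≟ b} (T-∧ˡ h₁) , toWitness {a? = p ≟ zero} (T-∧ʳ {⌊ i ≟ b ⌋} h₁))
... | inj₂ h₂ = inj₂ (toWitness {a? = i ≟ a} (T-∧ˡ h₂) , toWitness {a? = p ≟ fromℕ t′} (T-∧ʳ {⌊ i ≟ a ⌋} h₂))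

record PathAttached {n} t′ (A : Adjacency n) (a b : Fin n) (A′ : Adjacency (n + suc t′)) : Set where
  field
    symmetric : ∀ x y → A′ x y ≡ A′ y x
    old-old : ∀ i j → A′ (i ↑ˡ suc t′) (j ↑ˡ suc t′) ≡ A i j
    old-new : ∀ i p → A′ (i ↑ˡ suc t′) (n ↑ʳ p) ≡ attachments t′ a b i p
    new-new : ∀ p q → A′ (n ↑ʳ p) (n ↑ʳ q) ≡ consecutive (toℕ p) (toℕ q)

  new-old : ∀ p i → A′ (n ↑ʳ p) (i ↑ˡ suc t′) ≡ attachments t′ a b i p
  new-old p i = trans (symmetric _ _) (old-new i p)

paste-attached : ∀ {n} t′ (es : List (Edge n)) (a b : Fin n) →
  PathAttached t′ (listAdj es) a b (listAdj (pasteEdges n (suc t′) es a b))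
paste-attached {n} t′ es a b = record
  { symmetric = listAdj-sym (pasteEdges n t es a b)
  ; old-old = λ i j → trans (split (i ↑ˡ t) (j ↑ˡ t))
      (trans (cong₂ _∨_ (listAdj-map (_↑ˡ t) es (↑ˡ≟↑ˡ {n} {t} i) (↑ˡ≟↑ˡ {n} {t} j))
                        (cong₂ _∨_ (listAdj-outside (n ↑ʳ_) (pathEdges t) (i ↑ˡ t) (j ↑ˡ t) (↑ˡ≟↑ʳ {n} {t} i)) (ends-old i j)))
             (∨-identityʳ _))
  ; old-new = λ i p → trans (split (i ↑ˡ t) (n ↑ʳ p))
      (cong₂ _∨_ (trans (listAdj-sym lifted (i ↑ˡ t) (n ↑ʳ p))
                        (listAdj-outside (_↑ˡ t) es (n ↑ʳ p) (i ↑ˡ t) (λ u → ↑ʳ≟↑ˡ {n} {t} p u)))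
                 (cong₂ _∨_ (listAdj-outside (n ↑ʳ_) (pathEdges t) (i ↑ˡ t) (n ↑ʳ p) (↑ˡ≟↑ʳ {n} {t} i)) (ends-old-new i p)))
  ; new-new = λ p q → trans (split (n ↑ʳ p) (n ↑ʳ q))
      (cong₂ _∨_ (listAdj-outside (_↑ˡ t) es (n ↑ʳ p) (n ↑ʳ q) (λ u → ↑ʳ≟↑ˡ {n} {t} p u))
                 (trans (cong₂ _∨_ (trans (listAdj-map (n ↑ʳ_) (pathEdges t) (↑ʳ≟↑ʳ {n} {t} p) (↑ʳ≟↑ʳ {n} {t} q))
                                          (pathEdges-adj t p q))
                                   (ends-new p q))
                        (∨-identityʳ _)))
  }
  where
  t = suc t′
  lifted = map (mapE (_↑ˡ t)) es
  path = map (mapE (n ↑ʳ_)) (pathEdges t)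
  ends = connectors n t a b
  split : ∀ x y → listAdj (pasteEdges n t es a b) x y ≡ (listAdj lifted x y ∨ (listAdj path x y ∨ listAdj ends x y))
  split x y = trans (listAdj-++ lifted (path ++ ends) x y) (cong (listAdj lifted x y ∨_) (listAdj-++ path ends x y))
  ends-old : ∀ i j → listAdj ends (i ↑ˡ t) (j ↑ˡ t) ≡ false
  ends-old i j
    rewrite ↑ˡ≟↑ʳ {n} {t} i zero | ↑ˡ≟↑ʳ {n} {t} j zero | ↑ˡ≟↑ʳ {n} {t} i (fromℕ t′) | ↑ˡ≟↑ʳ {n} {t} j (fromℕ t′)
          | ∧-zeroʳ ⌊ i ↑ˡ t ≟ b ↑ˡ t ⌋ | ∧-zeroʳ ⌊ i ↑ˡ t ≟ a ↑ˡ t ⌋ = refl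
  ends-old-new : ∀ i p → listAdj ends (i ↑ˡ t) (n ↑ʳ p) ≡ attachments t′ a b i p
  ends-old-new i p
    rewrite ↑ˡ≟↑ˡ {n} {t} i b | ↑ʳ≟↑ʳ {n} {t} p zero | ↑ˡ≟↑ʳ {n} {t} i zero | ↑ˡ≟↑ʳ {n} {t} i (fromℕ t′)
          | ↑ˡ≟↑ˡ {n} {t} i a | ↑ʳ≟↑ʳ {n} {t} p (fromℕ t′)
          | ∨-identityʳ (⌊ i ≟ b ⌋ ∧ ⌊ p ≟ zero ⌋) | ∨-identityʳ (⌊ i ≟ a ⌋ ∧ ⌊ p ≟ fromℕ t′ ⌋) = refl
  ends-new : ∀ p q → listAdj ends (n ↑ʳ p) (n ↑ʳ q) ≡ false
  ends-new p q
    rewrite ↑ʳ≟↑ˡ {n} {t} p b | ↑ʳ≟↑ˡ {n} {t} q b | ↑ʳ≟↑ˡ {n} {t} p a | ↑ʳ≟↑ˡ {n} {t} q a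
          | ∧-zeroʳ ⌊ n ↑ʳ p ≟ n ↑ʳ zero ⌋ | ∧-zeroʳ ⌊ n ↑ʳ p ≟ n ↑ʳ fromℕ t′ ⌋ = refl

cycle-attached : ∀ k → let t′ = k + 3 * suc k in
  PathAttached t′ (listAdj (cycleEdges 1)) zero (suc zero) (listAdj (cycleEdges (suc (4 * suc k))))
cycle-attached k = record
  { symmetric = listAdj-sym (cycleEdges m)
  ; old-old = old-old
  ; old-new = old-new
  ; new-new = λ p q → trans (cycle-adj (suc (suc p)) (suc (suc q)))
      (cong (_∨ consecutive (toℕ p) (toℕ q)) (trans (∨-identityʳ _) (∧-zeroʳ ⌊ suc (suc p) ≟ fromℕ m ⌋)))
  }
  where
  t′ = k + 3 * suc k
  m = suc (4 * suc k)
  cycle-adj : ∀ x y → listAdj (cycleEdges m) x y ≡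
    (((⌊ x ≟ fromℕ m ⌋ ∧ ⌊ y ≟ zero ⌋) ∨ (⌊ x ≟ zero ⌋ ∧ ⌊ y ≟ fromℕ m ⌋)) ∨ consecutive (toℕ x) (toℕ y))
  cycle-adj x y =
    cong (((⌊ x ≟ fromℕ m ⌋ ∧ ⌊ y ≟ zero ⌋) ∨ (⌊ x ≟ zero ⌋ ∧ ⌊ y ≟ fromℕ m ⌋)) ∨_) (pathEdges-adj (suc m) x y)
  old-old : ∀ i j → listAdj (cycleEdges m) (i ↑ˡ suc t′) (j ↑ˡ suc t′) ≡ listAdj (cycleEdges 1) i j
  old-old zero zero = cycle-adj zero zero
  old-old zero (suc zero) = cycle-adj zero (suc zero)
  old-old (suc zero) zero = cycle-adj (suc zero) zero
  old-old (suc zero) (suc zero) = cycle-adj (suc zero) (suc zero)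
  old-new : ∀ i p → listAdj (cycleEdges m) (i ↑ˡ suc t′) (2 ↑ʳ p) ≡ attachments t′ zero (suc zero) i p
  old-new zero p = trans (cycle-adj zero (suc (suc p)))
    (trans (∨-identityʳ _) (trans (≟-injective suc suc-injective (suc p) (suc (fromℕ t′)))
                                  (≟-injective suc suc-injective p (fromℕ t′))))
  old-new (suc zero) p = trans (cycle-adj (suc zero) (suc (suc p))) (cong (_∨ false) (≡.sym (first p)))
    where
    first : ∀ p → ⌊ p ≟ zero ⌋ ≡ (0 ≡ᵇ toℕ p)
    first zero = refl
    first (suc p) = refl

evenPairs-member : ∀ t (p q : Fin t) → (p , q) ∈ evenPairs t → toℕ q ≡ suc (toℕ p) × T (even (toℕ p))
evenPairs-member (suc (suc l)) .zero .(suc zero) (here refl) = refl , tt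
evenPairs-member (suc (suc l)) p q (there h) with ∈-map⁻ (mapE (λ i → suc (suc i))) h
... | (p′ , q′) , h′ , refl = let q≡1+p , even-p = evenPairs-member l p′ q′ h′ in cong (λ k → suc (suc k)) q≡1+p , even-p

data PastedGreen {n t} (gs : List (Edge n)) : Fin (n + t) → Fin (n + t) → Set where
  oldGreen : ∀ {i j} → (i , j) ∈ gs → PastedGreen gs (i ↑ˡ t) (j ↑ˡ t)
  newGreen : ∀ p q → toℕ q ≡ suc (toℕ p) → T (even (toℕ p)) → PastedGreen gs (n ↑ʳ p) (n ↑ʳ q)

pastedGreen : ∀ {n t} (gs : List (Edge n)) {x y} → (x , y) ∈ pasteGreens n t gs → PastedGreen gs x y
pastedGreen {n} {t} gs h with ∈-++⁻ (map (mapE (_↑ˡ t)) gs) h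
... | inj₁ h₁ with ∈-map⁻ (mapE (_↑ˡ t)) h₁
...   | (i , j) , g , refl = oldGreen g
pastedGreen {n} {t} gs h | inj₂ h₂ with ∈-map⁻ (mapE (n ↑ʳ_)) h₂
...   | (p , q) , g , refl = let q≡1+p , even-p = evenPairs-member t p q g in newGreen p q q≡1+p even-p

-- Good weightings and the induction hypothesis

degree : ∀ {n} → Adjacency n → Adjacency n → Fin n → ℕ
degree {n} A w x = sum {n} λ y → bit (A x y ∧ w x y)

Bonus : ℕ → Set
Bonus n = Fin n → ℕ

degree⁺ : ∀ {n} → Adjacency n → Adjacency n → Bonus n → Fin n → ℕ
degree⁺ A w β x = degree A w x + β x

point : ∀ {n} → Fin n → Bonus n
point z x = bit ⌊ z ≟ x ⌋

points : ∀ {n} → Fin n → Fin n → Bonus n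
points u v x = point u x + point v x

notZeroTwo : ℕ → ℕ → Bool
notZeroTwo d d′ = not (((0 ≡ᵇ d) ∧ (2 ≡ᵇ d′)) ∨ ((2 ≡ᵇ d) ∧ (0 ≡ᵇ d′)))

record Good {n} (A : Adjacency n) (gs : List (Edge n)) (β : Bonus n) (w : Adjacency n) : Set where
  field
    symmetric : ∀ x y → w x y ≡ w y x
    proper : ∀ x y → A x y ≡ true → degree⁺ A w β x ≢ degree⁺ A w β y
    balanced : ∀ x y → (x , y) ∈ gs → T (notZeroTwo (degree⁺ A w β x) (degree⁺ A w β y))

Good-cong : ∀ {n} {A : Adjacency n} {gs β β′ w} → (∀ x → β x ≡ β′ x) → Good A gs β w → Good A gs β′ w
Good-cong {A = A} {β = β} {β′} {w} β≗β′ good = record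
  { symmetric = symmetric
  ; proper = λ x y adj eq → proper x y adj (trans (shift x) (trans eq (≡.sym (shift y))))
  ; balanced = λ x y g → subst T (cong₂ notZeroTwo (shift x) (shift y)) (balanced x y g)
  }
  where
  open Good good
  shift : ∀ x → degree⁺ A w β x ≡ degree⁺ A w β′ x
  shift x = cong (degree A w x +_) (β≗β′ x)

SameSide : ∀ {n} → Adjacency n → Fin n → Fin n → Set
SameSide {n} A u v = ∃ λ (c : Fin n → Bool) → (∀ x y → A x y ≡ true → c x ≢ c y) × c u ≡ c v

Pinned : ∀ {n} → Adjacency n → List (Edge n) → Fin n → Fin n → Bool → Set
Pinned A gs x y s = ∃ λ w → Good A gs (point x) w × degree⁺ A w (point x) x ≡ suc (bit s) × degree⁺ A w (point x) y ≡ bit s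

record Invariant {n} (A : Adjacency n) (gs : List (Edge n)) : Set where
  field
    greenAdjacent : ∀ {a b} → (a , b) ∈ gs → A a b ≡ true
    pinned : ∀ {a b} → (a , b) ∈ gs → ∀ s → Pinned A gs a b s × Pinned A gs b a s
    sameSide : ∀ u v → SameSide A u v → ∃ (Good A gs (points u v))

K₂ : Adjacency 2
K₂ = listAdj (cycleEdges 1)

green₂ : ∀ {x y : Fin 2} → (x , y) ∈ evenPairs 2 → (x ≡ zero) × (y ≡ suc zero)
green₂ (here refl) = refl , refl

constant : Bool → Adjacency 2
constant s _ _ = s

K₂-good : ∀ s (β : Bonus 2) → β zero ≢ β (suc zero) →
  T (notZeroTwo (degree⁺ K₂ (constant s) β zero) (degree⁺ K₂ (constant s) β (suc zero))) →
  Good K₂ (evenPairs 2) β (constant s)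
K₂-good s β β₀≢β₁ balanced₀₁ = record
  { symmetric = λ _ _ → refl
  ; proper = proper
  ; balanced = λ y z g → case green₂ g of λ { (refl , refl) → balanced₀₁ }
  }
  where
  proper : ∀ y z → K₂ y z ≡ true → degree⁺ K₂ (constant s) β y ≢ degree⁺ K₂ (constant s) β z
  proper zero (suc zero) _ eq = β₀≢β₁ (+-cancelˡ-≡ (bit s + 0) _ _ eq)
  proper (suc zero) zero _ eq = β₀≢β₁ (+-cancelˡ-≡ (bit s + 0) _ _ (≡.sym eq))

K₂-invariant : Invariant K₂ (evenPairs 2)
K₂-invariant = record
  { greenAdjacent = λ g → case green₂ g of λ { (refl , refl) → refl }
  ; pinned = λ g s → case green₂ g of λ { (refl , refl) → pinned s }
  ; sameSide = sameSide
  }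
  where
  pinned : ∀ s → Pinned K₂ (evenPairs 2) zero (suc zero) s × Pinned K₂ (evenPairs 2) (suc zero) zero s
  pinned false = (constant false , K₂-good false _ (λ ()) tt , refl , refl) , (constant false , K₂-good false _ (λ ()) tt , refl , refl)
  pinned true = (constant true , K₂-good true _ (λ ()) tt , refl , refl) , (constant true , K₂-good true _ (λ ()) tt , refl , refl)
  sameSide : ∀ u v → SameSide K₂ u v → ∃ (Good K₂ (evenPairs 2) (points u v))
  sameSide zero zero _ = constant true , K₂-good true _ (λ ()) tt
  sameSide (suc zero) (suc zero) _ = constant true , K₂-good true _ (λ ()) tt
  sameSide zero (suc zero) (c , proper , same) = ⊥-elim (proper zero (suc zero) refl same)
  sameSide (suc zero) zero (c , proper , same) = ⊥-elim (proper (suc zero) zero refl same)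

-- Weighting a path hung from b to a.  Vertex k lies between edge k and edge k+1; edge 0 goes to b
-- and the last edge to a.  A closing vertex ends a green pair, possibly with prescribed degrees for
-- the pair.  Scanning from b, the state is the weight of the last edge and the degree of the last vertex.

data PathVertex : Set where
  opening : ℕ → PathVertex
  closing : ℕ → Maybe (ℕ × ℕ) → PathVertex

bonusOf : PathVertex → ℕ
bonusOf (opening β) = β
bonusOf (closing β _) = β

vertex : Bool → ℕ → Maybe (ℕ × ℕ) → PathVertex
vertex true β _ = opening β
vertex false β target = closing β target

bonusOf-vertex : ∀ b β target → bonusOf (vertex b β target) ≡ β
bonusOf-vertex true β target = refl
bonusOf-vertex false β target = refl

pathWord : Bool → (ℕ → ℕ) → (ℕ → Maybe (ℕ × ℕ)) → ℕ → List PathVertex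
pathWord p β target zero = []
pathWord p β target (suc n) = vertex p (β 0) (target 0) ∷ pathWord (not p) (β ∘ suc) (target ∘ suc) n

zeros : Bool → ℕ → List PathVertex
zeros p = pathWord p (λ _ → 0) (λ _ → nothing)

opensAt : Bool → ℕ → Bool
opensAt p zero = p
opensAt p (suc k) = opensAt (not p) k

opensAt-true : ∀ k → opensAt true k ≡ even k
opensAt-true zero = refl
opensAt-true (suc zero) = refl
opensAt-true (suc (suc k)) = opensAt-true k

opensAt-odd : ∀ p m → T (not (even m)) → opensAt p m ≡ not p
opensAt-odd p (suc zero) _ = refl
opensAt-odd p (suc (suc m)) h = trans (cong (λ q → opensAt q m) (not-involutive p)) (opensAt-odd p m h)

record State : Set where
  constructor state
  field
    lastEdge : Bool
    lastDegree : ℕ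

open State

meets : Maybe (ℕ × ℕ) → ℕ → ℕ → Bool
meets nothing d d′ = true
meets (just (x , y)) d d′ = (d ≡ᵇ x) ∧ (d′ ≡ᵇ y)

pairCondition : PathVertex → ℕ → ℕ → Bool
pairCondition (opening _) d d′ = true
pairCondition (closing _ target) d d′ = notZeroTwo d d′ ∧ meets target d d′

degreeAt : State → Bool → PathVertex → ℕ
degreeAt s e v = bit (lastEdge s) + bit e + bonusOf v

admissible : State → PathVertex → Bool → Bool
admissible s v e = not (degreeAt s e v ≡ᵇ lastDegree s) ∧ pairCondition v (lastDegree s) (degreeAt s e v)

data Run : State → List PathVertex → State → Set where
  [] : ∀ {s} → Run s [] s
  step : ∀ {s v w s′} (e : Bool) → T (admissible s v e) → Run (state e (degreeAt s e v)) w s′ → Run s (v ∷ w) s′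

record Solution (s : State) (w : List PathVertex) (e : Bool) (d : ℕ) : Set where
  constructor solution
  field
    {final} : State
    run : Run s w final
    endsWith : lastEdge final ≡ e
    avoids : lastDegree final ≢ d

search : ∀ s w e d → Maybe (Solution s w e d)
search s [] e d with lastEdge s ≟ᵇ e | lastDegree s ℕ.≟ d
... | yes p | no q = just (solution [] p q)
... | _ | _ = nothing
search s (v ∷ w) e d = try false <∣> try true
  where
  try : Bool → Maybe (Solution s (v ∷ w) e d)
  try x with T? (admissible s v x)
  ... | no _ = nothing
  ... | yes ok = Maybe.map extend (search (state x (degreeAt s x v)) w e d)
    where
    extend : Solution (state x (degreeAt s x v)) w e d → Solution s (v ∷ w) e d
    extend (solution r p q) = solution (step x ok r) p q

infixr 5 _++ᴿ_

_++ᴿ_ : ∀ {s₁ s₂ s₃ u w} → Run s₁ u s₂ → Run s₂ w s₃ → Run s₁ (u ++ w) s₃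
[] ++ᴿ r = r
step e ok r₁ ++ᴿ r₂ = step e ok (r₁ ++ᴿ r₂)

block : List PathVertex
block = zeros true 4

-- After a bonus-free vertex, four bonus-free vertices can always lead back to the same state.
block-loop : ∀ e₀ e₁ → let s = state e₁ (bit e₀ + bit e₁ + 0) in Run s block s
block-loop false false = step true _ (step true _ (step false _ (step false _ [])))
block-loop false true = step true _ (step false _ (step false _ (step true _ [])))
block-loop true false = step false _ (step true _ (step true _ (step false _ [])))
block-loop true true = step false _ (step false _ (step true _ (step true _ [])))

infix 4 _⊑_

data _⊑_ : List PathVertex → List PathVertex → Set where
  here : ∀ {v w} → bonusOf v ≡ 0 → v ∷ w ⊑ v ∷ block ++ w
  there : ∀ {v w w′} → w ⊑ w′ → v ∷ w ⊑ v ∷ w′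

loop-after : ∀ {s v} e → bonusOf v ≡ 0 → let s′ = state e (degreeAt s e v) in Run s′ block s′
loop-after {s} e z rewrite z = block-loop (lastEdge s) e

pumpRun : ∀ {s w w′ s′} → w ⊑ w′ → Run s w s′ → Run s w′ s′
pumpRun (here z) (step {s} {v} e ok r) = step e ok (loop-after {s} {v} e z ++ᴿ r)
pumpRun (there p) (step e ok r) = step e ok (pumpRun p r)

pump : ∀ {s w w′ e d} → w ⊑ w′ → Solution s w e d → Solution s w′ e d
pump p (solution r q q′) = solution (pumpRun p r) q q′

pad : ∀ p n Q → zeros p (2 + n) ++ Q ⊑ zeros p (6 + n) ++ Q
pad true n Q = there (here refl)
pad false n Q = here refl

pad-end : ∀ p n → zeros p (2 + n) ⊑ zeros p (6 + n)
pad-end true n = there (here refl)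
pad-end false n = here refl

⊑-++ˡ : ∀ P {w w′} → w ⊑ w′ → P ++ w ⊑ P ++ w′
⊑-++ˡ [] p = p
⊑-++ˡ (v ∷ P) p = there (⊑-++ˡ P p)

data Padding : ℕ → Set where
  short : ∀ {n} → n < 6 → Padding n
  long : ∀ {n} → Padding (2 + n) → Padding (6 + n)

padding : ∀ n → Padding n
padding (suc (suc (suc (suc (suc (suc n)))))) = long (padding (suc (suc n)))
padding 0 = short (s≤s z≤n)
padding 1 = short (s≤s (s≤s z≤n))
padding 2 = short (s≤s (s≤s (s≤s z≤n)))
padding 3 = short (s≤s (s≤s (s≤s (s≤s z≤n))))
padding 4 = short (s≤s (s≤s (s≤s (s≤s (s≤s z≤n)))))
padding 5 = short (s≤s (s≤s (s≤s (s≤s (s≤s (s≤s z≤n))))))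

edgeWeight : ∀ {s w s′} → Run s w s′ → ℕ → Bool
edgeWeight {s} [] _ = lastEdge s
edgeWeight {s} (step _ _ _) zero = lastEdge s
edgeWeight (step _ _ r) (suc k) = edgeWeight r k

edgeWeight-first : ∀ {s w s′} (r : Run s w s′) → edgeWeight r 0 ≡ lastEdge s
edgeWeight-first [] = refl
edgeWeight-first (step _ _ _) = refl

edgeWeight-last : ∀ {p β target s s′} n (r : Run s (pathWord p β target n) s′) → edgeWeight r n ≡ lastEdge s′
edgeWeight-last zero [] = refl
edgeWeight-last (suc n) (step _ _ r) = edgeWeight-last n r

vertexDegree : (ℕ → Bool) → (ℕ → ℕ) → ℕ → ℕ
vertexDegree E β k = bit (E k) + bit (E (suc k)) + β k

previousDegree : ℕ → (ℕ → Bool) → (ℕ → ℕ) → ℕ → ℕ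
previousDegree d₀ E β zero = d₀
previousDegree d₀ E β (suc k) = vertexDegree E β k

admissibleAt : ∀ {p β target s s′} n (r : Run s (pathWord p β target n) s′) → ∀ k → k < n →
  let E = edgeWeight r in
  T (admissible (state (E k) (previousDegree (lastDegree s) E β k)) (vertex (opensAt p k) (β k) (target k)) (E (suc k)))
admissibleAt {p} {β} {target} {s} (suc n) (step e ok r) zero _ =
  subst (T ∘ admissible s (vertex p (β 0) (target 0))) (≡.sym (edgeWeight-first r)) ok
admissibleAt {p} {β} {target} {s} (suc n) (step e ok r) (suc k) (s≤s k<n) =
  subst (λ d → T (admissible (state (edgeWeight r k) d) (vertex (opensAt (not p) k) (β (suc k)) (target (suc k))) (edgeWeight r (suc k))))
    (previous k) (admissibleAt {not p} {β ∘ suc} {target ∘ suc} n r k k<n)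
  where
  previous : ∀ k → previousDegree (degreeAt s e (vertex p (β 0) (target 0))) (edgeWeight r) (β ∘ suc) k
                 ≡ previousDegree (lastDegree s) (edgeWeight (step e ok r)) β (suc k)
  previous zero = cong₂ (λ x y → bit (lastEdge s) + bit x + y) (≡.sym (edgeWeight-first r)) (bonusOf-vertex p (β 0) (target 0))
  previous (suc k) = refl

lastVertexDegree : ∀ {p β target s s′} m (r : Run s (pathWord p β target (suc m)) s′) →
  vertexDegree (edgeWeight r) β m ≡ lastDegree s′
lastVertexDegree {p} {β} {target} {s} zero (step e ok []) = cong (bit (lastEdge s) + bit e +_) (≡.sym (bonusOf-vertex p (β 0) (target 0)))
lastVertexDegree {p} {β} {target} (suc m) (step e ok r) = lastVertexDegree {not p} {β ∘ suc} {target ∘ suc} m r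

admissible-differs : ∀ st v e → T (admissible st v e) → degreeAt st e v ≢ lastDegree st
admissible-differs st v e ok = T-not-≡ᵇ (T-∧ˡ {not (degreeAt st e v ≡ᵇ lastDegree st)} ok)

closing-conditions : ∀ b β target st e → b ≡ false → T (admissible st (vertex b β target) e) →
  let d = degreeAt st e (vertex b β target) in T (notZeroTwo (lastDegree st) d) × T (meets target (lastDegree st) d)
closing-conditions false β target st e refl ok = T-∧ˡ pair , T-∧ʳ {notZeroTwo (lastDegree st) d} pair
  where
  d = degreeAt st e (closing β target)
  pair = T-∧ʳ {not (d ≡ᵇ lastDegree st)} ok

meets-just : ∀ {x y d d′} → T (meets (just (x , y)) d d′) → d ≡ x × d′ ≡ y
meets-just {x} {y} {d} {d′} h = ≡ᵇ⇒≡ d x (T-∧ˡ h) , ≡ᵇ⇒≡ d′ y (T-∧ʳ {d ≡ᵇ x} h)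

module RunFacts {p β target s s′} (n : ℕ) (r : Run s (pathWord p β target n) s′) where

  E : ℕ → Bool
  E = edgeWeight r

  d : ℕ → ℕ
  d = vertexDegree E β

  private
    degreeAt-vertex : ∀ k d₀ → degreeAt (state (E k) d₀) (E (suc k)) (vertex (opensAt p k) (β k) (target k)) ≡ d k
    degreeAt-vertex k d₀ = cong (bit (E k) + bit (E (suc k)) +_) (bonusOf-vertex (opensAt p k) (β k) (target k))

    differs : ∀ k → k < n → d k ≢ previousDegree (lastDegree s) E β k
    differs k k<n = subst (_≢ d₀) (degreeAt-vertex k d₀)
      (admissible-differs (state (E k) d₀) (vertex (opensAt p k) (β k) (target k)) (E (suc k)) (admissibleAt {p} {β} {target} n r k k<n))
      where
      d₀ = previousDegree (lastDegree s) E β k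

    closes : ∀ k → k < n → opensAt p k ≡ false → let d₀ = previousDegree (lastDegree s) E β k in
      T (notZeroTwo d₀ (d k)) × T (meets (target k) d₀ (d k))
    closes k k<n isClosing
      with closing-conditions (opensAt p k) (β k) (target k) (state (E k) (previousDegree (lastDegree s) E β k)) (E (suc k))
             isClosing (admissibleAt {p} {β} {target} n r k k<n)
    ... | balanced , met = subst (T ∘ notZeroTwo d₀) same balanced , subst (T ∘ meets (target k) d₀) same met
      where
      d₀ = previousDegree (lastDegree s) E β k
      same = degreeAt-vertex k d₀

  first-differs : 0 < n → d 0 ≢ lastDegree s
  first-differs = differs 0

  last-degree : ∀ {m} → n ≡ suc m → d m ≡ lastDegree s′
  last-degree {m} refl = lastVertexDegree {p} {β} {target} m r

  consecutive-differ : ∀ k → suc k < n → d k ≢ d (suc k)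
  consecutive-differ k k<n eq = differs (suc k) k<n (≡.sym eq)

  pair-balanced : ∀ k → suc k < n → opensAt p (suc k) ≡ false → T (notZeroTwo (d k) (d (suc k)))
  pair-balanced k k<n isClosing = proj₁ (closes (suc k) k<n isClosing)

  pair-target : ∀ k → suc k < n → opensAt p (suc k) ≡ false → ∀ {x y} → target (suc k) ≡ just (x , y) →
    d k ≡ x × d (suc k) ≡ y
  pair-target k k<n isClosing eq = meets-just (subst (λ tg → T (meets tg (d k) (d (suc k)))) eq (proj₂ (closes (suc k) k<n isClosing)))

single : ℕ → ℕ → ℕ → List PathVertex
single j β r = zeros true j ++ vertex (even j) β nothing ∷ zeros (not (even j)) r

twin : ℕ → ℕ → ℕ → List PathVertex
twin j m r = zeros true j ++ vertex (even j) 1 nothing ∷ zeros (not (even j)) m ++ vertex (even j) 1 nothing ∷ zeros (not (even j)) r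

pairTarget : Bool → Bool → ℕ × ℕ
pairTarget true s = suc (bit s) , bit s
pairTarget false s = bit s , suc (bit s)

pinnedPair : ℕ → Bool → Bool → ℕ → List PathVertex
pinnedPair j za s r = zeros true j ++ opening (bit za) ∷ closing (bit (not za)) (just (pairTarget za s)) ∷ zeros true r

-- The path is hung with a pinned weighting whose bonus sits at a (if za) or at b.  That bonus moves
-- onto the path edge at the same end, so the scan leaves b by edge (not za) and must end with edge za.
pinStart : Bool → Bool → State
pinStart za s = state (not za) (if za then bit s else suc (bit s))

pinAvoid : Bool → Bool → ℕ
pinAvoid za s = if za then suc (bit s) else bit s

PinnedSolution : List PathVertex → Set
PinnedSolution w = ∃₂ λ za s → Solution (pinStart za s) w za (pinAvoid za s)

searchPinned : ∀ w → Maybe (PinnedSolution w)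
searchPinned w = try true true <∣> try true false <∣> try false true <∣> try false false
  where
  try : ∀ za s → Maybe (PinnedSolution w)
  try za s = Maybe.map (λ sol → za , s , sol) (search (pinStart za s) w za (pinAvoid za s))

pumpPinned : ∀ {w w′} → w ⊑ w′ → PinnedSolution w → PinnedSolution w′
pumpPinned p (za , s , sol) = za , s , pump p sol

below6 : (ℕ → Bool) → Bool
below6 p = all p (upTo 6)

below6² : (ℕ → ℕ → Bool) → Bool
below6² p = below6 λ j → below6 (p j)

below6³ : (ℕ → ℕ → ℕ → Bool) → Bool
below6³ p = below6 λ j → below6² (p j)

below6-at : ∀ p → T (below6 p) → ∀ {j} → j < 6 → T (p j)
below6-at p = all-upTo p

below6²-at : ∀ p → T (below6² p) → ∀ {j r} → j < 6 → r < 6 → T (p j r)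
below6²-at p h j<6 r<6 = below6-at (p _) (below6-at (λ j → below6 (p j)) h j<6) r<6

below6³-at : ∀ p → T (below6³ p) → ∀ {j m r} → j < 6 → m < 6 → r < 6 → T (p j m r)
below6³-at p h j<6 m<6 r<6 = below6²-at (p _) (below6-at (λ j → below6² (p j)) h j<6) m<6 r<6

-- Path degrees are below 5, so a degree at a or b matters only through its value below 5.  Capping
-- the degree at b to 5 and at a to 6 keeps distinct degrees distinct.
cap : ℕ → ℕ → ℕ
cap c n = if ⌊ n ℕ.<? 5 ⌋ then n else c

cap-< : ∀ {c} n → 5 ≤ c → cap c n < suc c
cap-< {c} n 5≤c with n ℕ.<? 5
... | yes n<5 = <-≤-trans n<5 (m≤n⇒m≤1+n 5≤c)
... | no _ = n<1+n c

≡ᵇ-cap : ∀ {c} n {d} → d < 5 → 5 ≤ c → (d ≡ᵇ cap c n) ≡ (d ≡ᵇ n)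
≡ᵇ-cap {c} n {d} d<5 5≤c with n ℕ.<? 5
... | yes _ = refl
... | no n≮5 = trans (≡ᵇ-false {d} {c} λ { refl → <⇒≱ d<5 5≤c }) (≡.sym (≡ᵇ-false {d} {n} λ { refl → n≮5 d<5 }))

cap-≢ : ∀ {Da Db} → Da ≢ Db → cap 6 Da ≢ cap 5 Db
cap-≢ {Da} {Db} ne with Da ℕ.<? 5 | Db ℕ.<? 5
... | yes _ | yes _ = ne
... | yes Da<5 | no _ = λ { refl → <-irrefl refl Da<5 }
... | no _ | yes Db<5 = λ { refl → <⇒≱ Db<5 (n≤1+n 5) }
... | no _ | no _ = λ ()

≢-uncap : ∀ {c n d} → d < 5 → 5 ≤ c → d ≢ cap c n → d ≢ n
≢-uncap {c} {n} {d} d<5 5≤c ne refl =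
  ne (≡ᵇ⇒≡ d (cap c n) (subst T (≡.sym (≡ᵇ-cap n d<5 5≤c)) (≡⇒≡ᵇ d d refl)))

cap-notZeroTwo : ∀ Db Da → notZeroTwo (cap 6 Da) (cap 5 Db) ≡ notZeroTwo Da Db
cap-notZeroTwo Db Da
  rewrite ≡ᵇ-cap {6} Da {0} (s≤s z≤n) (n≤1+n 5) | ≡ᵇ-cap {6} Da {2} (s≤s (s≤s (s≤s z≤n))) (n≤1+n 5)
        | ≡ᵇ-cap {5} Db {0} (s≤s z≤n) ≤-refl | ≡ᵇ-cap {5} Db {2} (s≤s (s≤s (s≤s z≤n))) ≤-refl = refl

cap-≢0 : ∀ {c n} → 5 ≤ c → n ≢ 0 → T (not (0 ≡ᵇ cap c n))
cap-≢0 {c} {n} 5≤c n≢0 = subst (T ∘ not) (≡.sym (≡ᵇ-cap n (s≤s z≤n) 5≤c)) (T-≢ (λ 0≡n → n≢0 (≡.sym 0≡n)))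

smallBonuses : List PathVertex → Bool
smallBonuses = all (λ v → bonusOf v ≤ᵇ 2)

startsOpening : List PathVertex → Bool
startsOpening (opening _ ∷ _) = true
startsOpening _ = false

degreeAt<5 : ∀ s e v → bonusOf v ≤ 2 → degreeAt s e v < 5
degreeAt<5 s e v β≤2 = s≤s (+-mono-≤ (+-mono-≤ (bit≤1 (lastEdge s)) (bit≤1 e)) β≤2)

lastDegree<5 : ∀ {s v w s′} → Run s (v ∷ w) s′ → T (smallBonuses (v ∷ w)) → lastDegree s′ < 5
lastDegree<5 {s} {v} (step e _ []) h = degreeAt<5 s e v (≤ᵇ⇒≤ (bonusOf v) 2 (T-∧ˡ h))
lastDegree<5 {v = v} (step e _ r@(step _ _ _)) h = lastDegree<5 r (T-∧ʳ {bonusOf v ≤ᵇ 2} h)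

uncap : ∀ {e w c Db Da} → T (startsOpening w) → T (smallBonuses w) →
        Solution (state e (cap 5 Db)) w c (cap 6 Da) → Solution (state e Db) w c Da
uncap {e} {opening β ∷ w} {Db = Db} _ small (solution (step x ok r) p q) =
  solution (step x (subst (λ b → T (not b ∧ true)) (≡ᵇ-cap Db first<5 ≤-refl) ok) r) p
    (≢-uncap (lastDegree<5 {state e (cap 5 Db)} {opening β} (step x ok r) small) (n≤1+n 5) q)
  where
  first<5 : degreeAt (state e Db) x (opening β) < 5
  first<5 = degreeAt<5 (state e Db) x (opening β) (≤ᵇ⇒≤ β 2 (T-∧ˡ small))

boundaryChecks : Bool → List PathVertex → Bool → (ℕ → ℕ → Bool) → Bool
boundaryChecks e w c H = startsOpening w ∧ smallBonuses w ∧
  all (λ Db → all (λ Da → H Db Da ⇒ is-just (search (state e Db) w c Da)) (upTo 7)) (upTo 6)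

fromBoundaryChecks : ∀ e w c H → T (boundaryChecks e w c H) →
  ∀ {Db Da} → T (H (cap 5 Db) (cap 6 Da)) → Solution (state e Db) w c Da
fromBoundaryChecks e w c H h {Db} {Da} hyp =
  uncap (T-∧ˡ h) (T-∧ˡ (T-∧ʳ {startsOpening w} h)) (to-witness-T (search _ w c _) (⇒-elim entry hyp))
  where
  row : ℕ → Bool
  row Db = all (λ Da → H Db Da ⇒ is-just (search (state e Db) w c Da)) (upTo 7)
  table : T (all row (upTo 6))
  table = T-∧ʳ {smallBonuses w} (T-∧ʳ {startsOpening w} h)
  entry : T (H (cap 5 Db) (cap 6 Da) ⇒ is-just (search (state e (cap 5 Db)) w c (cap 6 Da)))
  entry = all-upTo (λ Da → H (cap 5 Db) Da ⇒ is-just (search (state e (cap 5 Db)) w c Da))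
            (all-upTo row table (cap-< Db ≤-refl)) (cap-< Da (n≤1+n 5))

plainBoundary : ℕ → ℕ → Bool
plainBoundary Db Da = not (Da ≡ᵇ Db)

plainCase : ℕ → Bool
plainCase t = (multipleOf4 t ∧ not (t ≡ᵇ 0)) ⇒ boundaryChecks false (zeros true t) false plainBoundary

plainChecks : T (below6 plainCase)
plainChecks = tt

solve-plain : ∀ {t} → Padding t → T (multipleOf4 t) → t ≢ 0 →
  ∀ {Db Da} → Da ≢ Db → Solution (state false Db) (zeros true t) false Da
solve-plain (long p) m _ ne = pump (pad-end true _) (solve-plain p m (λ ()) ne)
solve-plain {t} (short t<6) m t≢0 ne =
  fromBoundaryChecks false (zeros true t) false plainBoundary
    (⇒-elim (below6-at plainCase plainChecks t<6) (Equivalence.from T-∧ (m , T-≢ t≢0))) (T-≢ (cap-≢ ne))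

singleBoundary : ℕ → ℕ → ℕ → Bool
singleBoundary j Db Da = not (Da ≡ᵇ Db) ∧ notZeroTwo Da Db ∧ not (0 ≡ᵇ (if even j then Da else Db))

singleCase : ℕ → ℕ → Bool
singleCase j r = multipleOf4 (j + suc r) ⇒ boundaryChecks (not (even j)) (single j 1 r) (even j) (singleBoundary j)

singleChecks : T (below6² singleCase)
singleChecks = tt

singleBoundary-cap : ∀ j {Db Da} → Da ≢ Db → T (notZeroTwo Da Db) → (if even j then Da else Db) ≢ 0 →
  T (singleBoundary j (cap 5 Db) (cap 6 Da))
singleBoundary-cap j {Db} {Da} ne nzt pos = Equivalence.from T-∧ (T-≢ (cap-≢ ne) , Equivalence.from T-∧
  (subst T (≡.sym (cap-notZeroTwo Db Da)) nzt , positive (even j) pos))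
  where
  positive : ∀ b → (if b then Da else Db) ≢ 0 → T (not (0 ≡ᵇ (if b then cap 6 Da else cap 5 Db)))
  positive true = cap-≢0 (n≤1+n 5)
  positive false = cap-≢0 ≤-refl

solve-single : ∀ {j r} → Padding j → Padding r → T (multipleOf4 (j + suc r)) →
  ∀ {Db Da} → Da ≢ Db → T (notZeroTwo Da Db) → (if even j then Da else Db) ≢ 0 →
  Solution (state (not (even j)) Db) (single j 1 r) (even j) Da
solve-single {r = r} (long {j} pj) pr m ne nzt pos =
  pump (pad true j (vertex (even j) 1 nothing ∷ zeros (not (even j)) r)) (solve-single pj pr m ne nzt pos)
solve-single {j} (short j<6) (long {r} pr) m ne nzt pos =
  pump (⊑-++ˡ (zeros true j) (there (pad-end (not (even j)) r)))
    (solve-single (short j<6) pr (multipleOf4-skip j (3 + r) m) ne nzt pos)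
solve-single {j} {r} (short j<6) (short r<6) m ne nzt pos =
  fromBoundaryChecks (not (even j)) (single j 1 r) (even j) (singleBoundary j)
    (⇒-elim (below6²-at singleCase singleChecks j<6 r<6) m) (singleBoundary-cap j ne nzt pos)

doubleCase : ℕ → ℕ → Bool
doubleCase j r = multipleOf4 (j + suc r) ⇒ is-just (searchPinned (single j 2 r))

doubleChecks : T (below6² doubleCase)
doubleChecks = tt

solve-double : ∀ {j r} → Padding j → Padding r → T (multipleOf4 (j + suc r)) → PinnedSolution (single j 2 r)
solve-double {r = r} (long {j} pj) pr m =
  pumpPinned (pad true j (vertex (even j) 2 nothing ∷ zeros (not (even j)) r)) (solve-double pj pr m)
solve-double {j} (short j<6) (long {r} pr) m =
  pumpPinned (⊑-++ˡ (zeros true j) (there (pad-end (not (even j)) r)))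
    (solve-double (short j<6) pr (multipleOf4-skip j (3 + r) m))
solve-double {j} {r} (short j<6) (short r<6) m =
  to-witness-T (searchPinned (single j 2 r)) (⇒-elim (below6²-at doubleCase doubleChecks j<6 r<6) m)

twinCase : ℕ → ℕ → ℕ → Bool
twinCase j m r = (not (even m) ∧ multipleOf4 (j + suc (m + suc r))) ⇒ is-just (searchPinned (twin j m r))

twinChecks : T (below6³ twinCase)
twinChecks = tt

solve-twin : ∀ {j m r} → Padding j → Padding m → Padding r → T (not (even m)) →
  T (multipleOf4 (j + suc (m + suc r))) → PinnedSolution (twin j m r)
solve-twin {m = m} {r} (long {j} pj) pm pr o h =
  pumpPinned (pad true j (vertex (even j) 1 nothing ∷ zeros (not (even j)) m ++ vertex (even j) 1 nothing ∷ zeros (not (even j)) r))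
    (solve-twin pj pm pr o h)
solve-twin {j} {r = r} (short j<6) (long {m} pm) pr o h =
  pumpPinned (⊑-++ˡ (zeros true j) (there (pad (not (even j)) m (vertex (even j) 1 nothing ∷ zeros (not (even j)) r))))
    (solve-twin (short j<6) pm pr o (multipleOf4-skip j (3 + (m + suc r)) h))
solve-twin {j} {m} (short j<6) (short m<6) (long {r} pr) o h =
  pumpPinned (⊑-++ˡ (zeros true j) (there (⊑-++ˡ (zeros (not (even j)) m) (there (pad-end (not (even j)) r)))))
    (solve-twin (short j<6) (short m<6) pr o
      (multipleOf4-skip j (suc (m + suc (2 + r))) (subst (λ x → T (multipleOf4 (j + suc x))) (+4-inside m (3 + r)) h)))
solve-twin {j} {m} {r} (short j<6) (short m<6) (short r<6) o h =
  to-witness-T (searchPinned (twin j m r)) (⇒-elim (below6³-at twinCase twinChecks j<6 m<6 r<6) (Equivalence.from T-∧ (o , h)))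

allPins : (Bool → Bool → Bool) → Bool
allPins p = p false false ∧ p false true ∧ p true false ∧ p true true

allPins-at : ∀ p → T (allPins p) → ∀ za s → T (p za s)
allPins-at p h false false = T-∧ˡ h
allPins-at p h false true = T-∧ˡ (T-∧ʳ {p false false} h)
allPins-at p h true false = T-∧ˡ (T-∧ʳ {p false true} (T-∧ʳ {p false false} h))
allPins-at p h true true = T-∧ʳ {p true false} (T-∧ʳ {p false true} (T-∧ʳ {p false false} h))

pinnedCase : ℕ → ℕ → Bool
pinnedCase j r = (even j ∧ multipleOf4 (j + suc (suc r))) ⇒ allPins λ za s → is-just (searchPinned (pinnedPair j za s r))

pinnedChecks : T (below6² pinnedCase)
pinnedChecks = tt

solve-pinned : ∀ {j r} → Padding j → Padding r → T (even j) → T (multipleOf4 (j + suc (suc r))) →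
  ∀ za s → PinnedSolution (pinnedPair j za s r)
solve-pinned {r = r} (long {j} pj) pr e h za s =
  pumpPinned (pad true j (opening (bit za) ∷ closing (bit (not za)) (just (pairTarget za s)) ∷ zeros true r))
    (solve-pinned pj pr e h za s)
solve-pinned {j} (short j<6) (long {r} pr) e h za s =
  pumpPinned (⊑-++ˡ (zeros true j) (there (there (pad-end true r))))
    (solve-pinned (short j<6) pr e (multipleOf4-skip j (suc (suc (2 + r))) h) za s)
solve-pinned {j} {r} (short j<6) (short r<6) e h za s =
  to-witness-T (searchPinned (pinnedPair j za s r))
    (allPins-at (λ za s → is-just (searchPinned (pinnedPair j za s r)))
      (⇒-elim (below6²-at pinnedCase pinnedChecks j<6 r<6) (Equivalence.from T-∧ (e , h))) za s)

pathWord-++ : ∀ p β target m n →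
  pathWord p β target (m + n) ≡ pathWord p β target m ++ pathWord (opensAt p m) (β ∘ (m +_)) (target ∘ (m +_)) n
pathWord-++ p β target zero n = refl
pathWord-++ p β target (suc m) n = cong (vertex p (β 0) (target 0) ∷_) (pathWord-++ (not p) (β ∘ suc) (target ∘ suc) m n)

pathWord-zeros : ∀ p n {β target} → (∀ k → k < n → β k ≡ 0) → (∀ k → k < n → target k ≡ nothing) →
  pathWord p β target n ≡ zeros p n
pathWord-zeros p zero _ _ = refl
pathWord-zeros p (suc n) hβ ht =
  cong₂ _∷_ (cong₂ (vertex p) (hβ 0 (s≤s z≤n)) (ht 0 (s≤s z≤n)))
            (pathWord-zeros (not p) n (λ k k<n → hβ (suc k) (s≤s k<n)) (λ k k<n → ht (suc k) (s≤s k<n)))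

pathWord-peel : ∀ p J r {β target} → (∀ k → k < J → β k ≡ 0) → (∀ k → k < J → target k ≡ nothing) →
  pathWord p β target (J + suc r) ≡
  zeros p J ++ vertex (opensAt p J) (β J) (target J) ∷ pathWord (not (opensAt p J)) (λ k → β (J + suc k)) (λ k → target (J + suc k)) r
pathWord-peel p J r {β} {target} hβ ht = trans (pathWord-++ p β target J (suc r))
  (cong₂ _++_ (pathWord-zeros p J hβ ht)
              (cong₂ (λ x y → vertex (opensAt p J) x y ∷ pathWord (not (opensAt p J)) (λ k → β (J + suc k)) (λ k → target (J + suc k)) r)
                     (cong β (+-identityʳ J)) (cong target (+-identityʳ J))))

indicator : ℕ → ℕ → ℕ
indicator J k = bit (J ≡ᵇ k)

noTarget : ℕ → Maybe (ℕ × ℕ)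
noTarget _ = nothing

indicator-below : ∀ {J} k → k < J → indicator J k ≡ 0
indicator-below k k<J = cong bit (≡ᵇ-below k<J)

indicator-above : ∀ J k → indicator J (J + suc k) ≡ 0
indicator-above J k = cong bit (≡ᵇ-above J k)

pathWord-single : ∀ J r c {β} → (∀ k → k < J → β k ≡ 0) → β J ≡ c → (∀ k → β (J + suc k) ≡ 0) →
  pathWord true β noTarget (J + suc r) ≡ single J c r
pathWord-single J r c {β} before at after = trans (pathWord-peel true J r before (λ _ _ → refl))
  (cong (zeros true J ++_) (cong₂ _∷_ (cong₂ (λ b x → vertex b x nothing) (opensAt-true J) at)
    (trans (pathWord-zeros _ r (λ k _ → after k) (λ _ _ → refl)) (cong (λ b → zeros (not b) r) (opensAt-true J)))))

pathWord-twin : ∀ J m r {β} → T (not (even m)) → (∀ k → k < J → β k ≡ 0) → β J ≡ 1 →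
  (∀ k → k < m → β (J + suc k) ≡ 0) → β (J + suc m) ≡ 1 → (∀ k → β (J + suc (m + suc k)) ≡ 0) →
  pathWord true β noTarget (J + suc (m + suc r)) ≡ twin J m r
pathWord-twin J m r {β} odd before atJ between atL after = trans (pathWord-peel true J (m + suc r) before (λ _ _ → refl))
  (cong (zeros true J ++_) (cong₂ _∷_ (cong₂ (λ b x → vertex b x nothing) (opensAt-true J) atJ)
    (trans (pathWord-peel _ m r between (λ _ _ → refl))
      (cong₂ _++_ (cong (λ b → zeros (not b) m) (opensAt-true J))
        (cong₂ _∷_ (cong₂ (λ b x → vertex b x nothing) second atL)
          (trans (pathWord-zeros _ r (λ k _ → after k) (λ _ _ → refl)) (cong (λ b → zeros (not b) r) second)))))))
  where
  second : opensAt (not (opensAt true J)) m ≡ even J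
  second = trans (opensAt-odd _ m odd) (trans (not-involutive _) (opensAt-true J))

pathWord-pinned : ∀ j r za s {β target} → T (even j) → (∀ k → k < j → β k ≡ 0) → (∀ k → k < j → target k ≡ nothing) →
  β j ≡ bit za → target j ≡ nothing → β (j + 1) ≡ bit (not za) → target (j + 1) ≡ just (pairTarget za s) →
  (∀ k → β (j + suc (suc k)) ≡ 0) → (∀ k → target (j + suc (suc k)) ≡ nothing) →
  pathWord true β target (j + suc (suc r)) ≡ pinnedPair j za s r
pathWord-pinned j r za s {β} {target} ev before before′ atj atj′ next next′ after after′ =
  trans (pathWord-peel true j (suc r) before before′)
    (cong (zeros true j ++_) (cong₂ _∷_ (cong₂ (vertex (opensAt true j)) atj atj′ ⟨ trans ⟩ cong (λ b → vertex b (bit za) nothing) opens)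
      (cong₂ _∷_ (cong₂ (vertex (not (opensAt true j))) next next′
                    ⟨ trans ⟩ cong (λ b → vertex (not b) (bit (not za)) (just (pairTarget za s))) opens)
        (pathWord-zeros _ r (λ k _ → after k) (λ k _ → after′ k) ⟨ trans ⟩ cong (λ b → zeros (not (not b)) r) opens))))
  where
  opens : opensAt true j ≡ true
  opens = trans (opensAt-true j) (Equivalence.to T-≡ ev)

plain-path : ∀ t → T (multipleOf4 t) → t ≢ 0 → ∀ {Db Da} → Da ≢ Db →
  Solution (state false Db) (pathWord true (λ _ → 0) noTarget t) false Da
plain-path t = solve-plain (padding t)

single-path : ∀ J r → T (multipleOf4 (J + suc r)) → ∀ {Db Da} → Da ≢ Db → T (notZeroTwo Da Db) → (if even J then Da else Db) ≢ 0 →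
  Solution (state (not (even J)) Db) (pathWord true (indicator J) noTarget (J + suc r)) (even J) Da
single-path J r m ne nzt pos =
  subst (λ w → Solution _ w _ _) (≡.sym (pathWord-single J r 1 indicator-below (cong bit (≡ᵇ-refl J)) (indicator-above J)))
    (solve-single (padding J) (padding r) m ne nzt pos)

double-path : ∀ J r → T (multipleOf4 (J + suc r)) → PinnedSolution (pathWord true (λ k → indicator J k + indicator J k) noTarget (J + suc r))
double-path J r m =
  subst PinnedSolution (≡.sym (pathWord-single J r 2 (λ k k<J → cong₂ _+_ (indicator-below k k<J) (indicator-below k k<J))
                                               (cong (λ x → bit x + bit x) (≡ᵇ-refl J))
                                               (λ k → cong₂ _+_ (indicator-above J k) (indicator-above J k))))
    (solve-double (padding J) (padding r) m)

twin-path : ∀ J m r → T (not (even m)) → T (multipleOf4 (J + suc (m + suc r))) →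
  PinnedSolution (pathWord true (λ k → indicator J k + indicator (J + suc m) k) noTarget (J + suc (m + suc r)))
twin-path J m r odd h =
  subst PinnedSolution (≡.sym (pathWord-twin J m r odd
      (λ k k<J → cong₂ _+_ (indicator-below k k<J) (indicator-below k (<-trans k<J (m<m+n J (s≤s z≤n)))))
      (cong₂ _+_ (cong bit (≡ᵇ-refl J)) (indicator-below J (m<m+n J (s≤s z≤n))))
      (λ k k<m → cong₂ _+_ (indicator-above J k) (indicator-below (J + suc k) (+-monoʳ-< J (s≤s k<m))))
      (cong₂ _+_ (indicator-above J m) (cong bit (≡ᵇ-refl (J + suc m))))
      (λ k → cong₂ _+_ (indicator-above J (m + suc k))
                       (subst (λ x → indicator (J + suc m) x ≡ 0) (+-assoc J (suc m) (suc k)) (indicator-above (J + suc m) k)))))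
    (solve-twin (padding J) (padding m) (padding r) odd h)

pairTargetAt : ℕ → Bool → Bool → ℕ → Maybe (ℕ × ℕ)
pairTargetAt j za s k = if suc j ≡ᵇ k then just (pairTarget za s) else nothing

pinnedPosition : Bool → ℕ → ℕ
pinnedPosition za j = if za then j else suc j

pinned-path : ∀ j r za s → T (even j) → T (multipleOf4 (j + suc (suc r))) →
  PinnedSolution (pathWord true (indicator (pinnedPosition za j)) (pairTargetAt j za s) (j + suc (suc r)))
pinned-path j r za s ev h =
  subst PinnedSolution (≡.sym (pathWord-pinned j r za s ev (before za) before′ (at za) atj′ (next za) next′ (after za) after′))
    (solve-pinned (padding j) (padding r) ev h za s)
  where
  before : ∀ za k → k < j → indicator (pinnedPosition za j) k ≡ 0
  before true k k<j = indicator-below k k<j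
  before false k k<j = cong bit (≡ᵇ-suc-below (<⇒≤ k<j))
  before′ : ∀ k → k < j → pairTargetAt j za s k ≡ nothing
  before′ k k<j rewrite ≡ᵇ-suc-below (<⇒≤ k<j) = refl
  at : ∀ za → indicator (pinnedPosition za j) j ≡ bit za
  at true = cong bit (≡ᵇ-refl j)
  at false = cong bit (≡ᵇ-suc-below {j} ≤-refl)
  atj′ : pairTargetAt j za s j ≡ nothing
  atj′ rewrite ≡ᵇ-suc-below {j} ≤-refl = refl
  next : ∀ za → indicator (pinnedPosition za j) (j + 1) ≡ bit (not za)
  next true = indicator-above j 0
  next false = cong (λ k → bit (suc j ≡ᵇ k)) (+-comm j 1) ⟨ trans ⟩ cong bit (≡ᵇ-refl (suc j))
  next′ : pairTargetAt j za s (j + 1) ≡ just (pairTarget za s)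
  next′ rewrite +-comm j 1 | ≡ᵇ-refl j = refl
  after : ∀ za k → indicator (pinnedPosition za j) (j + suc (suc k)) ≡ 0
  after true k = indicator-above j (suc k)
  after false k rewrite +-suc j (suc k) = indicator-above j k
  after′ : ∀ k → pairTargetAt j za s (j + suc (suc k)) ≡ nothing
  after′ k rewrite +-suc j (suc k) | ≡ᵇ-above j k = refl

-- Extending a weighting along the path

split-by-end : ∀ bb aa f l e₀ eₜ → (f ∧ l) ≡ false →
  bit (((bb ∧ f) ∨ (aa ∧ l)) ∧ (if f then e₀ else eₜ)) ≡ bit (f ∧ (bb ∧ e₀)) + bit (l ∧ (aa ∧ eₜ))
split-by-end bb aa true true e₀ eₜ ()
split-by-end true true true false e₀ eₜ _ = ≡.sym (+-identityʳ _)
split-by-end true false true false e₀ eₜ _ = ≡.sym (+-identityʳ _)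
split-by-end false true true false e₀ eₜ _ = refl
split-by-end false false true false e₀ eₜ _ = refl
split-by-end true true false true e₀ eₜ _ = refl
split-by-end true false false true e₀ eₜ _ = refl
split-by-end false true false true e₀ eₜ _ = refl
split-by-end false false false true e₀ eₜ _ = refl
split-by-end true true false false e₀ eₜ _ = refl
split-by-end true false false false e₀ eₜ _ = refl
split-by-end false true false false e₀ eₜ _ = refl
split-by-end false false false false e₀ eₜ _ = refl

split-by-anchor : ∀ bb aa f l c → (bb ∧ aa) ≡ false →
  bit (((bb ∧ f) ∨ (aa ∧ l)) ∧ c) ≡ bit (bb ∧ (f ∧ c)) + bit (aa ∧ (l ∧ c))
split-by-anchor true true f l c ()
split-by-anchor true false true true c _ = ≡.sym (+-identityʳ _)
split-by-anchor true false true false c _ = ≡.sym (+-identityʳ _)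
split-by-anchor true false false true c _ = refl
split-by-anchor true false false false c _ = refl
split-by-anchor false true true true c _ = refl
split-by-anchor false true true false c _ = refl
split-by-anchor false true false true c _ = refl
split-by-anchor false true false false c _ = refl
split-by-anchor false false true true c _ = refl
split-by-anchor false false true false c _ = refl
split-by-anchor false false false true c _ = refl
split-by-anchor false false false false c _ = refl

path-neighbours : ∀ P Q (E : ℕ → Bool) →
  bit (consecutive P Q ∧ E (suc (P ⊓ Q))) ≡ bit ((suc P ≡ᵇ Q) ∧ E (suc P)) + bit ((P ≡ᵇ suc Q) ∧ E P)
path-neighbours zero zero E = refl
path-neighbours zero (suc zero) E = ≡.sym (+-identityʳ _)
path-neighbours zero (suc (suc Q)) E = refl
path-neighbours (suc zero) zero E = refl
path-neighbours (suc (suc P)) zero E = refl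
path-neighbours (suc P) (suc Q) E = path-neighbours P Q (E ∘ suc)

leftNeighbour : ℕ → ℕ → (ℕ → Bool) → ℕ
leftNeighbour t zero E = 0
leftNeighbour t (suc P) E = if P <ᵇ t then bit (E (suc P)) else 0

path-degree : ∀ t P (E : ℕ → Bool) →
  sum {t} (λ q → bit (consecutive P (toℕ q) ∧ E (suc (P ⊓ toℕ q)))) ≡
  (if suc P <ᵇ t then bit (E (suc P)) else 0) + leftNeighbour t P E
path-degree t P E = trans (sum-cong-≗ {t} (λ q → path-neighbours P (toℕ q) E))
  (trans (∑-distrib-+ {t} _ _) (cong₂ _+_ (sum-pointℕ t (suc P) (λ _ → E (suc P))) (left P)))
  where
  left : ∀ P → sum {t} (λ q → bit ((P ≡ᵇ suc (toℕ q)) ∧ E P)) ≡ leftNeighbour t P E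
  left zero = sum-zeros {t} _ (λ _ → refl)
  left (suc P) = sum-pointℕ t P (λ _ → E (suc P))

path-vertex-degree : ∀ t′ P (E : ℕ → Bool) → P ≤ t′ → 1 ≤ t′ → let connector = if P ≡ᵇ 0 then E 0 else E (suc t′) in
  bit ((P ≡ᵇ 0) ∧ connector) + bit ((P ≡ᵇ t′) ∧ connector) +
  ((if suc P <ᵇ suc t′ then bit (E (suc P)) else 0) + leftNeighbour (suc t′) P E) ≡ bit (E P) + bit (E (suc P))
path-vertex-degree (suc t′) zero E _ _ = cong₂ _+_ (+-identityʳ (bit (E 0))) (+-identityʳ (bit (E 1)))
path-vertex-degree t′ (suc P) E P<t′ _ with suc P ℕ.≟ t′
... | yes refl rewrite ≡ᵇ-refl P | <ᵇ-false {P} {P} (<-irrefl refl) | <ᵇ-true {P} {suc (suc P)} (m≤n⇒m≤1+n ≤-refl) =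
  +-comm (bit (E (suc (suc P)))) _
... | no P≢t′
  rewrite ≡ᵇ-false P≢t′ | <ᵇ-true {P} {suc t′} (m≤n⇒m≤1+n P<t′) | <ᵇ-true {suc P} {t′} (≤∧≢⇒< P<t′ P≢t′) =
  +-comm (bit (E (suc (suc P)))) _

pin-trade : ∀ {n} (a b : Fin n) za i → bit (⌊ i ≟ b ⌋ ∧ not za) + bit (⌊ i ≟ a ⌋ ∧ za) ≡ point (if za then a else b) i
pin-trade a b true i = cong₂ _+_ (cong bit (∧-zeroʳ ⌊ i ≟ b ⌋)) (cong bit (trans (∧-identityʳ _) (≟-sym i a)))
pin-trade a b false i =
  trans (cong₂ _+_ (cong bit (trans (∧-identityʳ _) (≟-sym i b))) (cong bit (∧-zeroʳ ⌊ i ≟ a ⌋))) (+-identityʳ _)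

module Attach {n t′ : ℕ} {A : Adjacency n} {a b : Fin n} {A′ : Adjacency (n + suc t′)}
  (attached : PathAttached t′ A a b A′) (a≢b : a ≢ b) (t′≥1 : 1 ≤ t′) where

  open PathAttached attached

  t : ℕ
  t = suc t′

  first last : Fin t → Bool
  first p = ⌊ p ≟ zero ⌋
  last p = ⌊ p ≟ fromℕ t′ ⌋

  connector : (ℕ → Bool) → Fin t → Bool
  connector E p = if first p then E 0 else E t

  extend⊎ : Adjacency n → (ℕ → Bool) → Fin n ⊎ Fin t → Fin n ⊎ Fin t → Bool
  extend⊎ w E (inj₁ i) (inj₁ j) = w i j
  extend⊎ w E (inj₁ i) (inj₂ p) = connector E p
  extend⊎ w E (inj₂ p) (inj₁ i) = connector E p
  extend⊎ w E (inj₂ p) (inj₂ q) = E (suc (toℕ p ⊓ toℕ q))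

  extend : Adjacency n → (ℕ → Bool) → Adjacency (n + t)
  extend w E x y = extend⊎ w E (splitAt n x) (splitAt n y)

  extend-symmetric : ∀ {w} E → (∀ i j → w i j ≡ w j i) → ∀ x y → extend w E x y ≡ extend w E y x
  extend-symmetric E w-sym x y = go (splitAt n x) (splitAt n y)
    where
    go : ∀ u v → extend⊎ _ E u v ≡ extend⊎ _ E v u
    go (inj₁ i) (inj₁ j) = w-sym i j
    go (inj₁ i) (inj₂ p) = refl
    go (inj₂ p) (inj₁ i) = refl
    go (inj₂ p) (inj₂ q) = cong (E ∘ suc) (⊓-comm (toℕ p) (toℕ q))

  module _ (w : Adjacency n) (E : ℕ → Bool) where

    private
      W = extend w E

    extend-old-old : ∀ i j → W (i ↑ˡ t) (j ↑ˡ t) ≡ w i j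
    extend-old-old i j rewrite splitAt-↑ˡ n i t | splitAt-↑ˡ n j t = refl

    extend-old-new : ∀ i p → W (i ↑ˡ t) (n ↑ʳ p) ≡ connector E p
    extend-old-new i p rewrite splitAt-↑ˡ n i t | splitAt-↑ʳ n t p = refl

    extend-new-old : ∀ p i → W (n ↑ʳ p) (i ↑ˡ t) ≡ connector E p
    extend-new-old p i rewrite splitAt-↑ˡ n i t | splitAt-↑ʳ n t p = refl

    extend-new-new : ∀ p q → W (n ↑ʳ p) (n ↑ʳ q) ≡ E (suc (toℕ p ⊓ toℕ q))
    extend-new-new p q rewrite splitAt-↑ʳ n t p | splitAt-↑ʳ n t q = refl

    first∧last : ∀ p → (first p ∧ last p) ≡ false
    first∧last zero =
      trans (≟-toℕ zero (fromℕ t′)) (trans (cong (0 ≡ᵇ_) (toℕ-fromℕ t′)) (≡ᵇ-false (λ 0≡t′ → <-irrefl 0≡t′ t′≥1)))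
    first∧last (suc p) = refl

    b∧a : ∀ i → (⌊ i ≟ b ⌋ ∧ ⌊ i ≟ a ⌋) ≡ false
    b∧a i with i ≟ b
    ... | yes refl = ≟-false (a≢b ∘ ≡.sym)
    ... | no _ = refl

    degree-old : ∀ i → degree A′ W (i ↑ˡ t) ≡ degree A w i + (bit (⌊ i ≟ b ⌋ ∧ E 0) + bit (⌊ i ≟ a ⌋ ∧ E t))
    degree-old i = begin
      degree A′ W (i ↑ˡ t)
        ≡⟨ sum-↑ n t _ ⟩
      sum {n} (λ j → bit (A′ (i ↑ˡ t) (j ↑ˡ t) ∧ W (i ↑ˡ t) (j ↑ˡ t))) +
      sum {t} (λ p → bit (A′ (i ↑ˡ t) (n ↑ʳ p) ∧ W (i ↑ˡ t) (n ↑ʳ p)))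
        ≡⟨ cong₂ _+_ (sum-cong-≗ {n} λ j → cong₂ (λ x y → bit (x ∧ y)) (old-old i j) (extend-old-old i j))
                     (sum-cong-≗ {t} λ p → trans (cong₂ (λ x y → bit (x ∧ y)) (old-new i p) (extend-old-new i p))
                                                 (split-by-end ⌊ i ≟ b ⌋ ⌊ i ≟ a ⌋ (first p) (last p) (E 0) (E t) (first∧last p))) ⟩
      degree A w i + sum {t} (λ p → bit (first p ∧ (⌊ i ≟ b ⌋ ∧ E 0)) + bit (last p ∧ (⌊ i ≟ a ⌋ ∧ E t)))
        ≡⟨ cong (degree A w i +_) (∑-distrib-+ {t} (λ p → bit (first p ∧ (⌊ i ≟ b ⌋ ∧ E 0)))
                                                    (λ p → bit (last p ∧ (⌊ i ≟ a ⌋ ∧ E t)))) ⟩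
      degree A w i + (sum {t} (λ p → bit (first p ∧ (⌊ i ≟ b ⌋ ∧ E 0))) + sum {t} (λ p → bit (last p ∧ (⌊ i ≟ a ⌋ ∧ E t))))
        ≡⟨ cong (degree A w i +_) (cong₂ _+_ (sum-point {t} zero (λ _ → ⌊ i ≟ b ⌋ ∧ E 0))
                                             (sum-point {t} (fromℕ t′) (λ _ → ⌊ i ≟ a ⌋ ∧ E t))) ⟩
      degree A w i + (bit (⌊ i ≟ b ⌋ ∧ E 0) + bit (⌊ i ≟ a ⌋ ∧ E t)) ∎
      where open ≡.≡-Reasoning

    degree-new : ∀ p → degree A′ W (n ↑ʳ p) ≡ bit (E (toℕ p)) + bit (E (suc (toℕ p)))
    degree-new p = begin
      degree A′ W (n ↑ʳ p)
        ≡⟨ sum-↑ n t _ ⟩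
      sum {n} (λ i → bit (A′ (n ↑ʳ p) (i ↑ˡ t) ∧ W (n ↑ʳ p) (i ↑ˡ t))) +
      sum {t} (λ q → bit (A′ (n ↑ʳ p) (n ↑ʳ q) ∧ W (n ↑ʳ p) (n ↑ʳ q)))
        ≡⟨ cong₂ _+_ (sum-cong-≗ {n} λ i → trans (cong₂ (λ x y → bit (x ∧ y)) (new-old p i) (extend-new-old p i))
                                                 (split-by-anchor ⌊ i ≟ b ⌋ ⌊ i ≟ a ⌋ (first p) (last p) (connector E p) (b∧a i)))
                     (sum-cong-≗ {t} λ q → cong₂ (λ x y → bit (x ∧ y)) (new-new p q) (extend-new-new p q)) ⟩
      sum {n} (λ i → bit (⌊ i ≟ b ⌋ ∧ (first p ∧ connector E p)) + bit (⌊ i ≟ a ⌋ ∧ (last p ∧ connector E p))) +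
      sum {t} (λ q → bit (consecutive (toℕ p) (toℕ q) ∧ E (suc (toℕ p ⊓ toℕ q))))
        ≡⟨ cong₂ _+_ (trans (∑-distrib-+ {n} (λ i → bit (⌊ i ≟ b ⌋ ∧ (first p ∧ connector E p)))
                                              (λ i → bit (⌊ i ≟ a ⌋ ∧ (last p ∧ connector E p))))
                            (cong₂ _+_ (sum-point {n} b (λ _ → first p ∧ connector E p)) (sum-point {n} a (λ _ → last p ∧ connector E p))))
                     (path-degree t (toℕ p) E) ⟩
      bit (first p ∧ connector E p) + bit (last p ∧ connector E p) +
      ((if suc (toℕ p) <ᵇ t then bit (E (suc (toℕ p))) else 0) + leftNeighbour t (toℕ p) E)
        ≡⟨ total ⟩
      bit (E (toℕ p)) + bit (E (suc (toℕ p))) ∎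
      where
      open ≡.≡-Reasoning
      total : bit (first p ∧ connector E p) + bit (last p ∧ connector E p) +
              ((if suc (toℕ p) <ᵇ t then bit (E (suc (toℕ p))) else 0) + leftNeighbour t (toℕ p) E)
            ≡ bit (E (toℕ p)) + bit (E (suc (toℕ p)))
      total rewrite ≟-toℕ p zero | ≟-toℕ p (fromℕ t′) | toℕ-fromℕ t′ = path-vertex-degree t′ (toℕ p) E (toℕ≤pred[n] p) t′≥1

  module Hang {gs : List (Edge n)} {w : Adjacency n} {βo : Bonus n} (good : Good A gs βo w)
    {β′ : Bonus (n + t)} {βp : ℕ → ℕ} {target : ℕ → Maybe (ℕ × ℕ)} {s₀ s₁ : State}
    (r : Run s₀ (pathWord true βp target t) s₁)
    (starts : lastDegree s₀ ≡ degree⁺ A w βo b) (ends : lastDegree s₁ ≢ degree⁺ A w βo a)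
    (traded : ∀ i → β′ (i ↑ˡ t) + (bit (⌊ i ≟ b ⌋ ∧ lastEdge s₀) + bit (⌊ i ≟ a ⌋ ∧ lastEdge s₁)) ≡ βo i)
    (onPath : ∀ p → β′ (n ↑ʳ p) ≡ βp (toℕ p)) where

    open Good good using (proper; balanced)
    open RunFacts {true} {βp} {target} t r public

    W : Adjacency (n + t)
    W = extend w E

    degree⁺-old : ∀ i → degree⁺ A′ W β′ (i ↑ˡ t) ≡ degree⁺ A w βo i
    degree⁺-old i = begin
      degree A′ W (i ↑ˡ t) + β′ (i ↑ˡ t)                                ≡⟨ cong (_+ β′ (i ↑ˡ t)) (degree-old w E i) ⟩
      degree A w i + (bit (⌊ i ≟ b ⌋ ∧ E 0) + bit (⌊ i ≟ a ⌋ ∧ E t)) + β′ (i ↑ˡ t)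
                                                                         ≡⟨ +-assoc (degree A w i) _ (β′ (i ↑ˡ t)) ⟩
      degree A w i + (bit (⌊ i ≟ b ⌋ ∧ E 0) + bit (⌊ i ≟ a ⌋ ∧ E t) + β′ (i ↑ˡ t))
                                                                         ≡⟨ cong (degree A w i +_) (+-comm _ (β′ (i ↑ˡ t))) ⟩
      degree A w i + (β′ (i ↑ˡ t) + (bit (⌊ i ≟ b ⌋ ∧ E 0) + bit (⌊ i ≟ a ⌋ ∧ E t)))
                                                                         ≡⟨ cong (degree A w i +_) (trans ends-of-run (traded i)) ⟩
      degree A w i + βo i                                                ∎
      where
      open ≡.≡-Reasoning
      ends-of-run : β′ (i ↑ˡ t) + (bit (⌊ i ≟ b ⌋ ∧ E 0) + bit (⌊ i ≟ a ⌋ ∧ E t))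
                  ≡ β′ (i ↑ˡ t) + (bit (⌊ i ≟ b ⌋ ∧ lastEdge s₀) + bit (⌊ i ≟ a ⌋ ∧ lastEdge s₁))
      ends-of-run = cong₂ (λ e₀ eₜ → β′ (i ↑ˡ t) + (bit (⌊ i ≟ b ⌋ ∧ e₀) + bit (⌊ i ≟ a ⌋ ∧ eₜ)))
                          (edgeWeight-first r) (edgeWeight-last {true} {βp} {target} t r)

    degree⁺-new : ∀ p → degree⁺ A′ W β′ (n ↑ʳ p) ≡ d (toℕ p)
    degree⁺-new p = cong₂ _+_ (degree-new w E p) (onPath p)

    old≢new : ∀ i p → attachments t′ a b i p ≡ true → degree⁺ A′ W β′ (i ↑ˡ t) ≢ degree⁺ A′ W β′ (n ↑ʳ p)
    old≢new i p adj eq with attachments-true t′ i p adj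
    ... | inj₁ (refl , refl) = first-differs (s≤s z≤n)
      (trans (≡.sym (degree⁺-new zero)) (trans (≡.sym eq) (trans (degree⁺-old b) (≡.sym starts))))
    ... | inj₂ (refl , refl) = ends
      (trans (≡.sym (last-degree refl)) (trans (cong d (≡.sym (toℕ-fromℕ t′)))
        (trans (≡.sym (degree⁺-new (fromℕ t′))) (trans (≡.sym eq) (degree⁺-old a)))))

    new≢new : ∀ p q → consecutive (toℕ p) (toℕ q) ≡ true → degree⁺ A′ W β′ (n ↑ʳ p) ≢ degree⁺ A′ W β′ (n ↑ʳ q)
    new≢new p q c eq with consecutive-true (toℕ p) (toℕ q) c
    ... | inj₁ 1+p≡q = consecutive-differ (toℕ p) (subst (_< t) (≡.sym 1+p≡q) (toℕ<n q))
                         (trans (≡.sym (degree⁺-new p)) (trans eq (trans (degree⁺-new q) (cong d (≡.sym 1+p≡q)))))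
    ... | inj₂ p≡1+q = consecutive-differ (toℕ q) (subst (_< t) p≡1+q (toℕ<n p))
                         (trans (≡.sym (degree⁺-new q)) (trans (≡.sym eq) (trans (degree⁺-new p) (cong d p≡1+q))))

    proper′ : ∀ x y → A′ x y ≡ true → degree⁺ A′ W β′ x ≢ degree⁺ A′ W β′ y
    proper′ x y adj with view n t x | view n t y
    ... | old i | old j = λ eq → proper i j (trans (≡.sym (old-old i j)) adj)
                                    (trans (≡.sym (degree⁺-old i)) (trans eq (degree⁺-old j)))
    ... | old i | new p = old≢new i p (trans (≡.sym (old-new i p)) adj)
    ... | new p | old i = λ eq → old≢new i p (trans (≡.sym (new-old p i)) adj) (≡.sym eq)
    ... | new p | new q = new≢new p q (trans (≡.sym (new-new p q)) adj)

    balanced′ : ∀ x y → (x , y) ∈ pasteGreens n t gs → T (notZeroTwo (degree⁺ A′ W β′ x) (degree⁺ A′ W β′ y))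
    balanced′ x y g with pastedGreen gs g
    ... | oldGreen {i} {j} g′ = subst T (cong₂ notZeroTwo (≡.sym (degree⁺-old i)) (≡.sym (degree⁺-old j))) (balanced i j g′)
    ... | newGreen p q q≡1+p even-p =
      subst T (cong₂ notZeroTwo (≡.sym (degree⁺-new p)) (trans (cong d (≡.sym q≡1+p)) (≡.sym (degree⁺-new q))))
        (pair-balanced (toℕ p) (subst (_< t) q≡1+p (toℕ<n q)) (opensAt-odd true (suc (toℕ p)) (odd-suc (toℕ p) even-p)))

    good′ : Good A′ (pasteGreens n t gs) β′ W
    good′ = record { symmetric = extend-symmetric E (Good.symmetric good) ; proper = proper′ ; balanced = balanced′ }

module Extend {n t′ : ℕ} {A : Adjacency n} {gs : List (Edge n)} {a b : Fin n} {A′ : Adjacency (n + suc t′)}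
  (attached : PathAttached t′ A a b A′) (mult4 : T (multipleOf4 (suc t′))) (ab∈gs : (a , b) ∈ gs) (inv : Invariant A gs) where

  open Invariant inv
  open PathAttached attached

  a≢b : a ≢ b
  a≢b refl = let w , good , _ = proj₁ (pinned ab∈gs true) in Good.proper good a a (greenAdjacent ab∈gs) refl

  t′≥1 : 1 ≤ t′
  t′≥1 = positive t′ mult4
    where
    positive : ∀ t′ → T (multipleOf4 (suc t′)) → 1 ≤ t′
    positive (suc t′) _ = s≤s z≤n

  open Attach attached a≢b t′≥1

  gs′ : List (Edge (n + t))
  gs′ = pasteGreens n t gs

  ends-differ : ∀ {β w} → Good A gs β w → degree⁺ A w β a ≢ degree⁺ A w β b
  ends-differ good = Good.proper good a b (greenAdjacent ab∈gs)

  hangPlain : ∀ {βo w} {β′ : Bonus (n + t)} → Good A gs βo w →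
    (∀ i → β′ (i ↑ˡ t) ≡ βo i) → (∀ p → β′ (n ↑ʳ p) ≡ 0) →
    ∃ λ W → Good A′ gs′ β′ W × (∀ i → degree⁺ A′ W β′ (i ↑ˡ t) ≡ degree⁺ A w βo i)
  hangPlain {βo} {w} {β′} good onOld onPath = H.W , H.good′ , H.degree⁺-old
    where
    sol = plain-path t mult4 (λ ()) (ends-differ good)
    open Solution sol
    no-trade : ∀ i → β′ (i ↑ˡ t) + (bit (⌊ i ≟ b ⌋ ∧ false) + bit (⌊ i ≟ a ⌋ ∧ lastEdge final)) ≡ βo i
    no-trade i rewrite endsWith | ∧-zeroʳ ⌊ i ≟ b ⌋ | ∧-zeroʳ ⌊ i ≟ a ⌋ = trans (+-identityʳ _) (onOld i)
    module H = Hang {gs} {w} {βo} good {β′} {λ _ → 0} {noTarget} run refl avoids no-trade onPath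

  lift-pinned : ∀ {x y s} → Pinned A gs x y s → Pinned A′ gs′ (x ↑ˡ t) (y ↑ˡ t) s
  lift-pinned {x} {y} (w , good , dx , dy) with hangPlain good (λ i → cong bit (↑ˡ≟↑ˡ x i)) (λ p → cong bit (↑ˡ≟↑ʳ x p))
  ... | W , good′ , preserved = W , good′ , trans (preserved x) dx , trans (preserved y) dy

  anchor : ∀ za s → let z = if za then a else b in ∃ λ w → Good A gs (point z) w ×
    lastDegree (pinStart za s) ≡ degree⁺ A w (point z) b × pinAvoid za s ≡ degree⁺ A w (point z) a
  anchor true s with proj₁ (pinned ab∈gs s)
  ... | w , good , da , db = w , good , ≡.sym db , ≡.sym da
  anchor false s with proj₂ (pinned ab∈gs s)
  ... | w , good , db , da = w , good , ≡.sym db , ≡.sym da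

  module HangPinned {βp target} {β′ : Bonus (n + t)} (sol : PinnedSolution (pathWord true βp target t))
    (onOld : ∀ i → β′ (i ↑ˡ t) ≡ 0) (onPath : ∀ p → β′ (n ↑ʳ p) ≡ βp (toℕ p)) where

    za = proj₁ sol
    s = proj₁ (proj₂ sol)
    open Solution (proj₂ (proj₂ sol))

    private
      anchored = anchor za s
      w = proj₁ anchored
      good = proj₁ (proj₂ anchored)
      z = if za then a else b

      traded : ∀ i → β′ (i ↑ˡ t) + (bit (⌊ i ≟ b ⌋ ∧ not za) + bit (⌊ i ≟ a ⌋ ∧ lastEdge final)) ≡ point z i
      traded i rewrite onOld i | endsWith = pin-trade a b za i

    open Hang {gs} {w} {point z} good {β′} {βp} {target} run (proj₁ (proj₂ (proj₂ anchored)))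
      (λ eq → avoids (trans eq (≡.sym (proj₂ (proj₂ (proj₂ anchored)))))) traded onPath public

  new-pinned : ∀ p q → toℕ q ≡ suc (toℕ p) → T (even (toℕ p)) → ∀ za s →
    Pinned A′ gs′ (n ↑ʳ (if za then p else q)) (n ↑ʳ (if za then q else p)) s
  new-pinned p q q≡1+p even-p za s = H.W , H.good′ , degrees za refl
    where
    j = toℕ p
    1+j<t : suc j < t
    1+j<t = subst (_< t) q≡1+p (toℕ<n q)
    r = proj₁ (decompose 1+j<t)
    length : t ≡ j + suc (suc r)
    length = trans (proj₂ (decompose 1+j<t)) (≡.sym (+-suc j (suc r)))
    sol : PinnedSolution (pathWord true (indicator (pinnedPosition za j)) (pairTargetAt j za s) t)
    sol = subst (PinnedSolution ∘ pathWord true _ _) (≡.sym length) (pinned-path j r za s even-p (subst (T ∘ multipleOf4) length mult4))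
    β′ : Bonus (n + t)
    β′ = point (n ↑ʳ (if za then p else q))
    position : ∀ za → toℕ (if za then p else q) ≡ pinnedPosition za j
    position true = refl
    position false = q≡1+p
    module H = HangPinned {indicator (pinnedPosition za j)} {pairTargetAt j za s} {point (n ↑ʳ (if za then p else q))}
      sol (λ i → cong bit (↑ʳ≟↑ˡ {n} {t} (if za then p else q) i))
      (λ p′ → cong bit (trans (↑ʳ≟↑ʳ {n} {t} (if za then p else q) p′)
                              (trans (≟-toℕ _ p′) (cong (_≡ᵇ toℕ p′) (position za)))))
    targets : H.d j ≡ proj₁ (pairTarget za s) × H.d (suc j) ≡ proj₂ (pairTarget za s)
    targets = H.pair-target j 1+j<t (opensAt-odd true (suc j) (odd-suc j even-p))
                (cong (λ b → if b then just (pairTarget za s) else nothing) (≡ᵇ-refl j))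
    at-p : degree⁺ A′ H.W β′ (n ↑ʳ p) ≡ proj₁ (pairTarget za s)
    at-p = trans (H.degree⁺-new p) (proj₁ targets)
    at-q : degree⁺ A′ H.W β′ (n ↑ʳ q) ≡ proj₂ (pairTarget za s)
    at-q = trans (H.degree⁺-new q) (trans (cong H.d q≡1+p) (proj₂ targets))
    degrees : ∀ za′ → za′ ≡ za → degree⁺ A′ H.W β′ (n ↑ʳ (if za′ then p else q)) ≡ suc (bit s) ×
                                  degree⁺ A′ H.W β′ (n ↑ʳ (if za′ then q else p)) ≡ bit s
    degrees true refl = at-p , at-q
    degrees false refl = at-q , at-p

  side : ℕ → Fin n
  side k = if even k then a else b

  module Colouring (c : Fin (n + t) → Bool) (proper-c : ∀ x y → A′ x y ≡ true → c x ≢ c y) where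

    ends-coloured : c (a ↑ˡ t) ≢ c (b ↑ˡ t)
    ends-coloured = proper-c (a ↑ˡ t) (b ↑ˡ t) (trans (old-old a b) (greenAdjacent ab∈gs))

    sides-differ : ∀ k → c (side (suc k) ↑ˡ t) ≢ c (side k ↑ˡ t)
    sides-differ k rewrite even-suc k with even k
    ... | true = ends-coloured ∘ ≡.sym
    ... | false = ends-coloured

    colour-at : ∀ k (k<t : k < t) → c (n ↑ʳ fromℕ< k<t) ≡ c (side k ↑ˡ t)
    colour-at zero _ = bool-third (proper-c (n ↑ʳ zero) (b ↑ˡ t) (trans (new-old zero b) first-attached)) ends-coloured
      where
      first-attached : attachments t′ a b b zero ≡ true
      first-attached rewrite ≟-refl b = refl
    colour-at (suc k) 1+k<t = bool-third
      (trans-≢ (proper-c (n ↑ʳ fromℕ< 1+k<t) (n ↑ʳ fromℕ< k<t) adjacent) (colour-at k k<t))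
      (sides-differ k)
      where
      k<t : k < t
      k<t = <-trans (n<1+n k) 1+k<t
      adjacent : A′ (n ↑ʳ fromℕ< 1+k<t) (n ↑ʳ fromℕ< k<t) ≡ true
      adjacent = trans (new-new (fromℕ< 1+k<t) (fromℕ< k<t))
        (trans (cong₂ consecutive (toℕ-fromℕ< 1+k<t) (toℕ-fromℕ< k<t))
               (trans (cong ((suc (suc k) ≡ᵇ k) ∨_) (≡ᵇ-refl k)) (∨-zeroʳ _)))

    side-parity : ∀ {P Q} → c (side P ↑ˡ t) ≡ c (side Q ↑ˡ t) → even P ≡ even Q
    side-parity {P} {Q} same with even P | even Q
    ... | true | true = refl
    ... | false | false = refl
    ... | true | false = ⊥-elim (ends-coloured same)
    ... | false | true = ⊥-elim (ends-coloured (≡.sym same))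

    path-colour : ∀ p → c (n ↑ʳ p) ≡ c (side (toℕ p) ↑ˡ t)
    path-colour p = subst (λ p′ → c (n ↑ʳ p′) ≡ c (side (toℕ p) ↑ˡ t)) (fromℕ<-toℕ p (toℕ<n p)) (colour-at (toℕ p) (toℕ<n p))

  restrict : ∀ {i j} (c : Fin (n + t) → Bool) → (∀ x y → A′ x y ≡ true → c x ≢ c y) →
    c (i ↑ˡ t) ≡ c (j ↑ˡ t) → SameSide A i j
  restrict c proper-c same = c ∘ (_↑ˡ t) , (λ x y adj → proper-c (x ↑ˡ t) (y ↑ˡ t) (trans (old-old x y) adj)) , same

  old-old-side : ∀ i j → SameSide A′ (i ↑ˡ t) (j ↑ˡ t) → ∃ (Good A′ gs′ (points (i ↑ˡ t) (j ↑ˡ t)))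
  old-old-side i j (c , proper-c , same) with sameSide i j (restrict c proper-c same)
  ... | w , good with hangPlain good (λ k → cong₂ _+_ (cong bit (↑ˡ≟↑ˡ i k)) (cong bit (↑ˡ≟↑ˡ j k)))
                                     (λ p → cong₂ _+_ (cong bit (↑ˡ≟↑ʳ i p)) (cong bit (↑ˡ≟↑ʳ j p)))
  ...   | W , good′ , _ = W , good′

  bonus-positive : ∀ {w} i z → degree⁺ A w (points i z) z ≢ 0
  bonus-positive {w} i z = subst (_≢ 0) (≡.sym (cong (λ x → degree A w z + (bit ⌊ i ≟ z ⌋ + bit x)) (≟-refl z)
                                          ⟨ trans ⟩ (cong (degree A w z +_) (+-comm _ 1) ⟨ trans ⟩ +-suc _ _))) λ ()

  side-positive : ∀ {w} i e → let z = if e then a else b in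
    (if e then degree⁺ A w (points i z) a else degree⁺ A w (points i z) b) ≢ 0
  side-positive {w} i true = bonus-positive {w} i a
  side-positive {w} i false = bonus-positive {w} i b

  old-new-side : ∀ i p → SameSide A′ (i ↑ˡ t) (n ↑ʳ p) → ∃ (Good A′ gs′ (points (i ↑ˡ t) (n ↑ʳ p)))
  old-new-side i p (c , proper-c , same) = H.W , H.good′
    where
    J = toℕ p
    z = side J
    open Colouring c proper-c
    anchored = sameSide i z (restrict c proper-c (trans same (path-colour p)))
    w = proj₁ anchored
    good = proj₂ anchored
    r = proj₁ (decompose (toℕ<n p))
    length : t ≡ J + suc r
    length = proj₂ (decompose (toℕ<n p))
    Da = degree⁺ A w (points i z) a
    Db = degree⁺ A w (points i z) b
    sol : Solution (state (not (even J)) Db) (pathWord true (indicator J) noTarget t) (even J) Da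
    sol = subst (λ len → Solution (state (not (even J)) Db) (pathWord true (indicator J) noTarget len) (even J) Da) (≡.sym length)
      (single-path J r (subst (T ∘ multipleOf4) length mult4) (ends-differ good) (Good.balanced good a b ab∈gs) (side-positive {w} i (even J)))
    open Solution sol
    traded : ∀ k → points (i ↑ˡ t) (n ↑ʳ p) (k ↑ˡ t) + (bit (⌊ k ≟ b ⌋ ∧ not (even J)) + bit (⌊ k ≟ a ⌋ ∧ lastEdge final))
                 ≡ points i z k
    traded k rewrite endsWith | ↑ˡ≟↑ˡ {n} {t} i k | ↑ʳ≟↑ˡ {n} {t} p k =
      trans (+-assoc (bit ⌊ i ≟ k ⌋) 0 _) (cong (bit ⌊ i ≟ k ⌋ +_) (pin-trade a b (even J) k))
    module H = Hang {gs} {w} {points i z} good {points (i ↑ˡ t) (n ↑ʳ p)} {indicator J} {noTarget} run refl avoids traded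
      (λ p′ → cong₂ _+_ (cong bit (↑ˡ≟↑ʳ i p′)) (cong bit (trans (↑ʳ≟↑ʳ p p′) (≟-toℕ p p′))))

  double-side : ∀ p → ∃ (Good A′ gs′ (points (n ↑ʳ p) (n ↑ʳ p)))
  double-side p = H.W , H.good′
    where
    J = toℕ p
    r = proj₁ (decompose (toℕ<n p))
    length : t ≡ J + suc r
    length = proj₂ (decompose (toℕ<n p))
    sol = subst (PinnedSolution ∘ pathWord true _ noTarget) (≡.sym length) (double-path J r (subst (T ∘ multipleOf4) length mult4))
    toPath : ∀ p′ → point (n ↑ʳ p) (n ↑ʳ p′) ≡ indicator J (toℕ p′)
    toPath p′ = cong bit (trans (↑ʳ≟↑ʳ {n} {t} p p′) (≟-toℕ p p′))
    module H = HangPinned {λ k → indicator J k + indicator J k} {noTarget} {points (n ↑ʳ p) (n ↑ʳ p)} sol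
      (λ i → cong₂ _+_ (cong bit (↑ʳ≟↑ˡ p i)) (cong bit (↑ʳ≟↑ˡ p i)))
      (λ p′ → cong₂ _+_ (toPath p′) (toPath p′))

  twin-side : ∀ p q → toℕ p < toℕ q → even (toℕ p) ≡ even (toℕ q) → ∃ (Good A′ gs′ (points (n ↑ʳ p) (n ↑ʳ q)))
  twin-side p q p<q same-parity = H.W , H.good′
    where
    J = toℕ p
    m = proj₁ (decompose p<q)
    gap : toℕ q ≡ J + suc m
    gap = proj₂ (decompose p<q)
    r = proj₁ (decompose (toℕ<n q))
    length : t ≡ J + suc (m + suc r)
    length = trans (proj₂ (decompose (toℕ<n q))) (trans (cong (_+ suc r) gap) (+-assoc J (suc m) (suc r)))
    sol = subst (PinnedSolution ∘ pathWord true _ noTarget) (≡.sym length)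
      (twin-path J m r (odd-gap J m (trans same-parity (cong even gap))) (subst (T ∘ multipleOf4) length mult4))
    toPath : ∀ x p′ → point (n ↑ʳ x) (n ↑ʳ p′) ≡ indicator (toℕ x) (toℕ p′)
    toPath x p′ = cong bit (trans (↑ʳ≟↑ʳ {n} {t} x p′) (≟-toℕ x p′))
    module H = HangPinned {λ k → indicator J k + indicator (J + suc m) k} {noTarget} {points (n ↑ʳ p) (n ↑ʳ q)} sol
      (λ i → cong₂ _+_ (cong bit (↑ʳ≟↑ˡ p i)) (cong bit (↑ʳ≟↑ˡ q i)))
      (λ p′ → cong₂ _+_ (toPath p p′) (trans (toPath q p′) (cong (λ x → indicator x (toℕ p′)) gap)))

  swapped : ∀ {x y} → ∃ (Good A′ gs′ (points y x)) → ∃ (Good A′ gs′ (points x y))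
  swapped {x} {y} (W , good) = W , Good-cong (λ k → +-comm (point y k) (point x k)) good

  new-new-side : ∀ p q → SameSide A′ (n ↑ʳ p) (n ↑ʳ q) → ∃ (Good A′ gs′ (points (n ↑ʳ p) (n ↑ʳ q)))
  new-new-side p q (c , proper-c , same) = compare (ℕ.<-cmp (toℕ p) (toℕ q))
    where
    open Colouring c proper-c
    parity : even (toℕ p) ≡ even (toℕ q)
    parity = side-parity {toℕ p} {toℕ q} (trans (≡.sym (path-colour p)) (trans same (path-colour q)))
    compare : Tri (toℕ p < toℕ q) (toℕ p ≡ toℕ q) (toℕ q < toℕ p) → ∃ (Good A′ gs′ (points (n ↑ʳ p) (n ↑ʳ q)))
    compare (tri< p<q _ _) = twin-side p q p<q parity
    compare (tri≈ _ p≡q _) rewrite toℕ-injective p≡q = double-side q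
    compare (tri> _ _ q<p) = swapped {n ↑ʳ p} {n ↑ʳ q} (twin-side q p q<p (≡.sym parity))

  private
    adjacent : ∀ {x y} → PastedGreen gs x y → A′ x y ≡ true
    adjacent (oldGreen g) = trans (old-old _ _) (greenAdjacent g)
    adjacent (newGreen p q q≡1+p _) =
      trans (new-new p q) (trans (cong (consecutive (toℕ p)) q≡1+p) (cong (_∨ (toℕ p ≡ᵇ suc (suc (toℕ p)))) (≡ᵇ-refl (toℕ p))))

    pinned′ : ∀ {x y} → PastedGreen gs x y → ∀ s → Pinned A′ gs′ x y s × Pinned A′ gs′ y x s
    pinned′ (oldGreen g) s = lift-pinned (proj₁ (pinned g s)) , lift-pinned (proj₂ (pinned g s))
    pinned′ (newGreen p q q≡1+p even-p) s = new-pinned p q q≡1+p even-p true s , new-pinned p q q≡1+p even-p false s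

    sameSide′ : ∀ u v → SameSide A′ u v → ∃ (Good A′ gs′ (points u v))
    sameSide′ u v same with view n t u | view n t v
    ... | old i | old j = old-old-side i j same
    ... | old i | new p = old-new-side i p same
    ... | new p | old i = swapped {n ↑ʳ p} {i ↑ˡ t} (old-new-side i p (proj₁ same , proj₁ (proj₂ same) , ≡.sym (proj₂ (proj₂ same))))
    ... | new p | new q = new-new-side p q same

  invariant : Invariant A′ gs′
  invariant = record
    { greenAdjacent = adjacent ∘ pastedGreen gs
    ; pinned = pinned′ ∘ pastedGreen gs
    ; sameSide = sameSide′
    }

-- Relabelling vertices, and the theorem

module Relabel {m k : ℕ} (σ : Fin m ↔ Fin k) {A : Adjacency m} {B : Adjacency k}
  (preserves : ∀ x y → A x y ≡ B (Inverse.to σ x) (Inverse.to σ y)) where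

  open Inverse σ using (to; from; strictlyInverseˡ; strictlyInverseʳ)

  to-injective : ∀ {x y} → to x ≡ to y → x ≡ y
  to-injective {x} {y} eq = trans (≡.sym (strictlyInverseʳ x)) (trans (cong from eq) (strictlyInverseʳ y))

  point-to : ∀ z x → point (to z) (to x) ≡ point z x
  point-to z x = cong bit (≟-injective to to-injective z x)

  relabel : Adjacency k → Adjacency m
  relabel w x y = w (to x) (to y)

  degree-relabel : ∀ w x → degree A (relabel w) x ≡ degree B w (to x)
  degree-relabel w x = trans (sum-cong-≗ {m} λ y → cong (λ e → bit (e ∧ w (to x) (to y))) (preserves x y))
                             (≡.sym (sum-permute (λ y → bit (B (to x) y ∧ w (to x) y)) σ))

  good-relabel : ∀ {gs gs′ β w} → (∀ {x y} → (x , y) ∈ gs′ → (to x , to y) ∈ gs) →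
    Good B gs β w → Good A gs′ (β ∘ to) (relabel w)
  good-relabel {β = β} {w} greens good = record
    { symmetric = λ x y → symmetric (to x) (to y)
    ; proper = λ x y adj eq → proper (to x) (to y) (trans (≡.sym (preserves x y)) adj)
                                (trans (≡.sym (shift x)) (trans eq (shift y)))
    ; balanced = λ x y g → subst T (cong₂ notZeroTwo (≡.sym (shift x)) (≡.sym (shift y))) (balanced (to x) (to y) (greens g))
    }
    where
    open Good good
    shift : ∀ x → degree⁺ A (relabel w) (β ∘ to) x ≡ degree⁺ B w β (to x)
    shift x = cong (_+ β (to x)) (degree-relabel w x)

  sameSide-relabel : ∀ {u v} → SameSide A u v → SameSide B (to u) (to v)
  sameSide-relabel {u} {v} (c , proper-c , same) =
    c ∘ from ,
    (λ x y adj → proper-c (from x) (from y) (trans (preserves (from x) (from y)) (subst₂-adj x y adj))) ,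
    trans (cong c (strictlyInverseʳ u)) (trans same (≡.sym (cong c (strictlyInverseʳ v))))
    where
    subst₂-adj : ∀ x y → B x y ≡ true → B (to (from x)) (to (from y)) ≡ true
    subst₂-adj x y adj = trans (cong₂ B (strictlyInverseˡ x) (strictlyInverseˡ y)) adj

  invariant-relabel : ∀ {gs gs′} → (∀ {x y} → (x , y) ∈ gs′ → (to x , to y) ∈ gs) →
    Invariant B gs → Invariant A gs′
  invariant-relabel {gs} {gs′} greens inv = record
    { greenAdjacent = λ {x} {y} g → trans (preserves x y) (greenAdjacent (greens g))
    ; pinned = λ g s → lift (proj₁ (pinned (greens g) s)) , lift (proj₂ (pinned (greens g) s))
    ; sameSide = λ u v same → let w , good = sameSide (to u) (to v) (sameSide-relabel same) in
        relabel w , Good-cong (λ x → cong₂ _+_ (point-to u x) (point-to v x)) (good-relabel greens good)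
    }
    where
    open Invariant inv
    lift : ∀ {x y s} → Pinned B gs (to x) (to y) s → Pinned A gs′ x y s
    lift {x} {y} (w , good , dx , dy) =
      relabel w , Good-cong (point-to x) (good-relabel greens good) ,
      trans (cong₂ _+_ (degree-relabel w x) (≡.sym (point-to x x))) dx ,
      trans (cong₂ _+_ (degree-relabel w y) (≡.sym (point-to x y))) dy

unpadded : ∀ n → Fin (n + 0) ↔ Fin n
unpadded n = mk↔ₛ′ (cast (+-identityʳ n)) (_↑ˡ 0)
  (λ i → toℕ-injective (trans (toℕ-cast _ (i ↑ˡ 0)) (toℕ-↑ˡ i 0)))
  (λ x → toℕ-injective (trans (toℕ-↑ˡ _ 0) (toℕ-cast _ x)))

paste-nothing : ∀ {n} {es : List (Edge n)} {a b gs} → Invariant (listAdj es) gs →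
  Invariant (listAdj (pasteEdges n 0 es a b)) (pasteGreens n 0 gs)
paste-nothing {n} {es} {a} {b} {gs} = invariant-relabel greens
  where
  σ = unpadded n
  open Inverse σ using (to; strictlyInverseˡ; strictlyInverseʳ)
  at : ∀ x u → ⌊ x ≟ u ↑ˡ 0 ⌋ ≡ ⌊ to x ≟ u ⌋
  at x u = trans (cong (λ x′ → ⌊ x′ ≟ u ↑ˡ 0 ⌋) (≡.sym (strictlyInverseʳ x))) (↑ˡ≟↑ˡ (to x) u)
  preserves : ∀ x y → listAdj (pasteEdges n 0 es a b) x y ≡ listAdj es (to x) (to y)
  preserves x y = trans (listAdj-++ (map (mapE (_↑ˡ 0)) es) [] x y)
    (trans (∨-identityʳ _) (listAdj-map (_↑ˡ 0) es (at x) (at y)))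
  open Relabel σ {B = listAdj es} preserves
  greens : ∀ {x y} → (x , y) ∈ pasteGreens n 0 gs → (to x , to y) ∈ gs
  greens g with pastedGreen gs g
  ... | oldGreen {i} {j} g′ = subst₂ (λ i′ j′ → (i′ , j′) ∈ gs) (≡.sym (strictlyInverseˡ i)) (≡.sym (strictlyInverseˡ j)) g′

cactus-invariant : ∀ {m es gs} → OddCactus m es gs → Invariant (listAdj es) gs
cactus-invariant (cyc zero) = K₂-invariant
cactus-invariant (cyc (suc k)) = Extend.invariant (cycle-attached k) (multipleOf4-4* (suc k)) (here refl) K₂-invariant
cactus-invariant (paste {es = es} cactus a b g zero) = paste-nothing {es = es} {a} {b} (cactus-invariant cactus)
cactus-invariant (paste {n} {es} cactus a b g (suc k)) =
  Extend.invariant (paste-attached (k + 3 * suc k) es a b) (multipleOf4-4* (suc k)) g (cactus-invariant cactus)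

lemma8 : (G : SimpleGraph) → IsSimpleOddMultiCactus G → ¬ (G ≅ K2) →
    (u v : Fin (n G)) → SameClass G u v →
    ∃ λ (w : Fin (n G) → Fin (n G) → Bool) →
      (∀ x y → w x y ≡ w y x) ×
      (∀ x y → Adj G x y ≡ true →
        modifiedDegree G w u v x ≢ modifiedDegree G w u v y)
lemma8 G (m , es , gs , cactus , σ , preserves) _ u v same = relabel w , Good.symmetric good′ , proper
  where
  open Relabel σ {B = listAdj es} preserves
  side = Invariant.sameSide (cactus-invariant cactus) _ _ (sameSide-relabel same)
  w = proj₁ side
  good′ : Good (Adj G) [] (points u v) (relabel w)
  good′ = Good-cong (λ x → cong₂ _+_ (point-to u x) (point-to v x)) (good-relabel (λ ()) (proj₂ side))
  modified : ∀ x → modifiedDegree G (relabel w) u v x ≡ degree⁺ (Adj G) (relabel w) (points u v) x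
  modified x = trans (+-assoc _ (point u x) (point v x)) (cong (_+ points u v x) (sum-allFin (n G) _))
  proper : ∀ x y → Adj G x y ≡ true → modifiedDegree G (relabel w) u v x ≢ modifiedDegree G (relabel w) u v y
  proper x y adj eq = Good.proper good′ x y adj (trans (≡.sym (modified x)) (trans eq (modified y)))
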